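{- Let $\mathbf{G3X}$ be any one of the calculi $\mathbf{G3E}$, $\mathbf{G3EN}$, $\mathbf{G3M}$, $\mathbf{G3MN}$, $\mathbf{G3C}$, $\mathbf{G3CN}$, $\mathbf{G3R}$, $\mathbf{G3K}$, $\mathbf{G3ED^\bot}$, $\mathbf{G3END^\bot}$, $\mathbf{G3ED^\Diamond}$, $\mathbf{G3ED}$, $\mathbf{G3END}$, $\mathbf{G3MD^\bot}$, $\mathbf{G3MND^\bot}$, $\mathbf{G3MD}$, $\mathbf{G3MND}$, $\mathbf{G3CD^\Diamond}$, $\mathbf{G3CD}$, $\mathbf{G3CND}$, $\mathbf{G3RD}$, $\mathbf{G3KD}$. The cut rule is admissible in $\mathbf{G3X}$: for all formulas $D$ and finite multisets $\Gamma,\Delta,\Pi,\Sigma$, if $\Gamma\Rightarrow\Delta,D$ and $D,\Pi\Rightarrow\Sigma$ are derivable in $\mathbf{G3X}$, then $\Gamma,\Pi\Rightarrow\Delta,\Sigma$ is derivable in $\mathbf{G3X}$.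
   Context: Formulas are generated from countably many propositional variables $p_0,p_1,\dots$ and the $0$-ary constant $\bot$ by the binary connectives $\wedge,\vee,\supset$ and the unary operator $\Box$; $\neg A:=A\supset\bot$, $\top:=\bot\supset\bot$, $\Diamond A:=\neg\Box\neg A$. A sequent is an expression $\Gamma\Rightarrow\Delta$ with $\Gamma,\Delta$ finite, possibly empty, multisets of formulas; if $\Pi=A_1,\dots,A_m$ then $\Box\Pi=\Box A_1,\dots,\Box A_m$. The calculus $\mathbf{G3cp}$ has initial sequents $p,\Gamma\Rightarrow\Delta,p$ ($p$ a propositional variable), the zero-premiss rule $L\bot$ with conclusion $\bot,\Gamma\Rightarrow\Delta$, and the rules (premisses / conclusion): $L\wedge$: $A,B,\Gamma\Rightarrow\Delta$ / $A\wedge B,\Gamma\Rightarrow\Delta$; $R\wedge$: $\Gamma\Rightarrow\Delta,A$ and $\Gamma\Rightarrow\Delta,B$ / $\Gamma\Rightarrow\Delta,A\wedge B$; $L\vee$: $A,\Gamma\Rightarrow\Delta$ and $B,\Gamma\Rightarrow\Delta$ / $A\vee B,\Gamma\Rightarrow\Delta$; $R\vee$: $\Gamma\Rightarrow\Delta,A,B$ / $\Gamma\Rightarrow\Delta,A\vee B$; $L\supset$: $\Gamma\Rightarrow\Delta,A$ and $B,\Gamma\Rightarrow\Delta$ / $A\supset B,\Gamma\Rightarrow\Delta$; $R\supset$: $A,\Gamma\Rightarrow\Delta,B$ / $\Gamma\Rightarrow\Delta,A\supset B$. Modal and deontic rules ($\Gamma,\Delta$ arbitrary multisets): $LR$-$E$: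 $A\Rightarrow B$ and $B\Rightarrow A$ / $\Box A,\Gamma\Rightarrow\Delta,\Box B$; $LR$-$M$: $A\Rightarrow B$ / $\Box A,\Gamma\Rightarrow\Delta,\Box B$; $LR$-$R$: $A,\Pi\Rightarrow B$ / $\Box A,\Box\Pi,\Gamma\Rightarrow\Delta,\Box B$; $LR$-$C$ (for each $n\ge1$): $A_1,\dots,A_n\Rightarrow B$ and $B\Rightarrow A_1$, …, $B\Rightarrow A_n$ / $\Box A_1,\dots,\Box A_n,\Gamma\Rightarrow\Delta,\Box B$; $LR$-$K$: $\Pi\Rightarrow B$ / $\Box\Pi,\Gamma\Rightarrow\Delta,\Box B$; $R$-$N$: $\Rightarrow B$ / $\Gamma\Rightarrow\Delta,\Box B$; $L$-$D^\bot$: $A\Rightarrow$ / $\Box A,\Gamma\Rightarrow\Delta$; $L$-$D^{\Diamond_E}$ ($|\Pi|\le2$): $\Pi\Rightarrow$ and $\Rightarrow\Pi$ / $\Box\Pi,\Gamma\Rightarrow\Delta$; $L$-$D^{\Diamond_M}$ ($|\Pi|\le2$): $\Pi\Rightarrow$ / $\Box\Pi,\Gamma\Rightarrow\Delta$; $L$-$D^{\Diamond_C}$: $\Pi,\Sigma\Rightarrow$ and $\Rightarrow A,B$ for every $A\in\Pi$, $B\in\Sigma$ / $\Box\Pi,\Box\Sigma,\Gamma\Rightarrow\Delta$; $L$-$D^*$: $\Pi\Rightarrow$ / $\Box\Pi,\Gamma\Rightarrow\Delta$. Each calculus is $\mathbf{G3cp}$ plus: $\mathbf{G3E}$: $LR$-$E$;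 $\mathbf{G3EN}$: $LR$-$E$, $R$-$N$; $\mathbf{G3M}$: $LR$-$M$; $\mathbf{G3MN}$: $LR$-$M$, $R$-$N$; $\mathbf{G3C}$: $LR$-$C$; $\mathbf{G3CN}$: $LR$-$C$, $R$-$N$; $\mathbf{G3R}$: $LR$-$R$; $\mathbf{G3K}$: $LR$-$K$; $\mathbf{G3ED^\bot}$ / $\mathbf{G3END^\bot}$: rules of $\mathbf{G3E}$ / $\mathbf{G3EN}$ plus $L$-$D^\bot$; $\mathbf{G3ED^\Diamond}$: rules of $\mathbf{G3E}$ plus $L$-$D^{\Diamond_E}$; $\mathbf{G3ED}$ / $\mathbf{G3END}$: rules of $\mathbf{G3E}$ / $\mathbf{G3EN}$ plus $L$-$D^\bot$ and $L$-$D^{\Diamond_E}$; $\mathbf{G3MD^\bot}$ / $\mathbf{G3MND^\bot}$: rules of $\mathbf{G3M}$ / $\mathbf{G3MN}$ plus $L$-$D^\bot$; $\mathbf{G3MD}$ / $\mathbf{G3MND}$: rules of $\mathbf{G3M}$ / $\mathbf{G3MN}$ plus $L$-$D^{\Diamond_M}$; $\mathbf{G3CD^\Diamond}$: rules of $\mathbf{G3C}$ plus $L$-$D^{\Diamond_C}$; $\mathbf{G3CD}$, $\mathbf{G3CND}$, $\mathbf{G3RD}$, $\mathbf{G3KD}$: rules of $\mathbf{G3C}$, $\mathbf{G3CN}$, $\mathbf{G3R}$, $\mathbf{G3K}$ respectively plus $L$-$D^*$. A derivation is a finite upward-growing tree of sequents whose leaves are initial sequents or conclusions of $L\bot$ and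 each other node is the conclusion of a rule instance whose premisses are its children. -}

module Defs where

open import Data.Nat using (ℕ; _≤_)
open import Data.Bool using (Bool; true; false; T)
open import Data.List using (List; []; _∷_; _++_; map; length)
open import Data.List.Relation.Unary.All using (All)
open import Data.List.Relation.Binary.Permutation.Propositional using (_↭_)

infixr 30 _∧'_
infixr 29 _∨'_
infixr 28 _⊃_

data Fm : Set where
  var   : ℕ → Fm
  ⊥'    : Fm
  _∧'_  : Fm → Fm → Fm
  _∨'_  : Fm → Fm → Fm
  _⊃_   : Fm → Fm → Fm
  □     : Fm → Fm

¬' : Fm → Fm
¬' A = A ⊃ ⊥'

⊤' : Fm
⊤' = ⊥' ⊃ ⊥'

◇ : Fm → Fm
◇ A = ¬' (□ (¬' A))

□* : List Fm → List Fm
□* = map □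

data ModalRule : Set where
  LR-E LR-M LR-R LR-C LR-K R-N L-D⊥ L-D◇E L-D◇M L-D◇C L-D* : ModalRule

data Calc : Set where
  G3E G3EN G3M G3MN G3C G3CN G3R G3K : Calc
  G3ED⊥ G3END⊥ G3ED◇ G3ED G3END : Calc
  G3MD⊥ G3MND⊥ G3MD G3MND : Calc
  G3CD◇ G3CD G3CND G3RD G3KD : Calc

has : Calc → ModalRule → Bool
has G3E     LR-E  = true
has G3EN    LR-E  = true
has G3EN    R-N   = true
has G3M     LR-M  = true
has G3MN    LR-M  = true
has G3MN    R-N   = true
has G3C     LR-C  = true
has G3CN    LR-C  = true
has G3CN    R-N   = true
has G3R     LR-R  = true
has G3K     LR-K  = true
has G3ED⊥   LR-E  = true
has G3ED⊥   L-D⊥  = true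
has G3END⊥  LR-E  = true
has G3END⊥  R-N   = true
has G3END⊥  L-D⊥  = true
has G3ED◇   LR-E  = true
has G3ED◇   L-D◇E = true
has G3ED    LR-E  = true
has G3ED    L-D⊥  = true
has G3ED    L-D◇E = true
has G3END   LR-E  = true
has G3END   R-N   = true
has G3END   L-D⊥  = true
has G3END   L-D◇E = true
has G3MD⊥   LR-M  = true
has G3MD⊥   L-D⊥  = true
has G3MND⊥  LR-M  = true
has G3MND⊥  R-N   = true
has G3MND⊥  L-D⊥  = true
has G3MD    LR-M  = true
has G3MD    L-D◇M = true
has G3MND   LR-M  = true
has G3MND   R-N   = true
has G3MND   L-D◇M = true
has G3CD◇   LR-C  = true
has G3CD◇   L-D◇C = true
has G3CD    LR-C  = true
has G3CD    L-D*  = true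
has G3CND   LR-C  = true
has G3CND   R-N   = true
has G3CND   L-D*  = true
has G3RD    LR-R  = true
has G3RD    L-D*  = true
has G3KD    LR-K  = true
has G3KD    L-D*  = true
has _       _     = false

-- Sequents are multisets, represented by lists; every rule's conclusion is
-- given up to permutation (_↭_) of antecedent and succedent, so a list
-- sequent is derivable iff the multiset sequent it represents is.
infix 4 _⊢_⇒_
data _⊢_⇒_ (X : Calc) : List Fm → List Fm → Set where
  init : ∀ {Γ' Δ'} p Γ Δ → Γ' ↭ var p ∷ Γ → Δ' ↭ var p ∷ Δ → X ⊢ Γ' ⇒ Δ'
  L⊥   : ∀ {Γ' Δ} Γ → Γ' ↭ ⊥' ∷ Γ → X ⊢ Γ' ⇒ Δ
  L∧   : ∀ {Γ' Δ} A B Γ → Γ' ↭ A ∧' B ∷ Γ →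
         X ⊢ A ∷ B ∷ Γ ⇒ Δ → X ⊢ Γ' ⇒ Δ
  R∧   : ∀ {Γ Δ'} A B Δ → Δ' ↭ A ∧' B ∷ Δ →
         X ⊢ Γ ⇒ A ∷ Δ → X ⊢ Γ ⇒ B ∷ Δ → X ⊢ Γ ⇒ Δ'
  L∨   : ∀ {Γ' Δ} A B Γ → Γ' ↭ A ∨' B ∷ Γ →
         X ⊢ A ∷ Γ ⇒ Δ → X ⊢ B ∷ Γ ⇒ Δ → X ⊢ Γ' ⇒ Δ
  R∨   : ∀ {Γ Δ'} A B Δ → Δ' ↭ A ∨' B ∷ Δ →
         X ⊢ Γ ⇒ A ∷ B ∷ Δ → X ⊢ Γ ⇒ Δ'
  L⊃   : ∀ {Γ' Δ} A B Γ → Γ' ↭ A ⊃ B ∷ Γ →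
         X ⊢ Γ ⇒ A ∷ Δ → X ⊢ B ∷ Γ ⇒ Δ → X ⊢ Γ' ⇒ Δ
  R⊃   : ∀ {Γ Δ'} A B Δ → Δ' ↭ A ⊃ B ∷ Δ →
         X ⊢ A ∷ Γ ⇒ B ∷ Δ → X ⊢ Γ ⇒ Δ'
  lr-E : ∀ {Γ' Δ'} → T (has X LR-E) → ∀ A B Γ Δ →
         Γ' ↭ □ A ∷ Γ → Δ' ↭ □ B ∷ Δ →
         X ⊢ A ∷ [] ⇒ B ∷ [] → X ⊢ B ∷ [] ⇒ A ∷ [] → X ⊢ Γ' ⇒ Δ'
  lr-M : ∀ {Γ' Δ'} → T (has X LR-M) → ∀ A B Γ Δ →
         Γ' ↭ □ A ∷ Γ → Δ' ↭ □ B ∷ Δ →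
         X ⊢ A ∷ [] ⇒ B ∷ [] → X ⊢ Γ' ⇒ Δ'
  lr-R : ∀ {Γ' Δ'} → T (has X LR-R) → ∀ A Π B Γ Δ →
         Γ' ↭ □ A ∷ □* Π ++ Γ → Δ' ↭ □ B ∷ Δ →
         X ⊢ A ∷ Π ⇒ B ∷ [] → X ⊢ Γ' ⇒ Δ'
  lr-C : ∀ {Γ' Δ'} → T (has X LR-C) → ∀ A As B Γ Δ →
         Γ' ↭ □* (A ∷ As) ++ Γ → Δ' ↭ □ B ∷ Δ →
         X ⊢ A ∷ As ⇒ B ∷ [] →
         All (λ C → X ⊢ B ∷ [] ⇒ C ∷ []) (A ∷ As) → X ⊢ Γ' ⇒ Δ'
  lr-K : ∀ {Γ' Δ'} → T (has X LR-K) → ∀ Π B Γ Δ →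
         Γ' ↭ □* Π ++ Γ → Δ' ↭ □ B ∷ Δ →
         X ⊢ Π ⇒ B ∷ [] → X ⊢ Γ' ⇒ Δ'
  r-N  : ∀ {Γ Δ'} → T (has X R-N) → ∀ B Δ → Δ' ↭ □ B ∷ Δ →
         X ⊢ [] ⇒ B ∷ [] → X ⊢ Γ ⇒ Δ'
  l-D⊥ : ∀ {Γ' Δ} → T (has X L-D⊥) → ∀ A Γ → Γ' ↭ □ A ∷ Γ →
         X ⊢ A ∷ [] ⇒ [] → X ⊢ Γ' ⇒ Δ
  l-D◇E : ∀ {Γ' Δ} → T (has X L-D◇E) → ∀ Π Γ → length Π ≤ 2 →
         Γ' ↭ □* Π ++ Γ →
         X ⊢ Π ⇒ [] → X ⊢ [] ⇒ Π → X ⊢ Γ' ⇒ Δ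
  l-D◇M : ∀ {Γ' Δ} → T (has X L-D◇M) → ∀ Π Γ → length Π ≤ 2 →
         Γ' ↭ □* Π ++ Γ →
         X ⊢ Π ⇒ [] → X ⊢ Γ' ⇒ Δ
  l-D◇C : ∀ {Γ' Δ} → T (has X L-D◇C) → ∀ Π Ψ Γ →
         Γ' ↭ □* Π ++ □* Ψ ++ Γ →
         X ⊢ Π ++ Ψ ⇒ [] →
         All (λ A → All (λ B → X ⊢ [] ⇒ A ∷ B ∷ []) Ψ) Π →
         X ⊢ Γ' ⇒ Δ
  l-D* : ∀ {Γ' Δ} → T (has X L-D*) → ∀ Π Γ →
         Γ' ↭ □* Π ++ Γ →
         X ⊢ Π ⇒ [] → X ⊢ Γ' ⇒ Δ

module Submission where

-- The proof is the syntactic one of Negri and von Plato.  Every later induction then treats the modal rules in one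
--    clause; modal steps are never affected by the side formulas Γ, Δ.
--  * Exchange and weakening hold by induction on derivations; so does
--    invertibility of the propositional rules; contraction is proved by
--    induction on the contracted formula and then on the derivation.
--  * Cut is proved by induction on the cut formula D, then on the left
--    derivation until D is principal in it, then on the right derivation until
--    D is principal there as well.  A principal propositional cut becomes cuts
--    on subformulas followed by contractions; a principal cut on □B between two
--    modal steps merges them into one modal step of the same calculus, or
--    yields the empty sequent.  Pairs of rules that never occur together in one
--    calculus are excluded by evaluating `has` on all 22 calculi.

open import Defs
open import Data.Nat using (_≤_; z≤n; s≤s)
open import Data.Nat.Properties using (≤-trans; n≤1+n)
open import Data.Bool using (Bool; true; T; not; _∧_; _∨_)
open import Data.Unit using (⊤; tt)
open import Data.Empty using (⊥; ⊥-elim)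
open import Data.Product using (Σ; _×_; _,_; proj₁; proj₂)
open import Data.Sum using (_⊎_; inj₁; inj₂)
open import Data.List using (List; []; _∷_; _++_; length)
import Data.List.Properties as List
open import Data.List.Relation.Unary.All using (All; []; _∷_)
import Data.List.Relation.Unary.All as All
import Data.List.Relation.Unary.All.Properties as AllP
open import Data.List.Relation.Unary.Any using (here; there)
open import Data.List.Membership.Propositional.Properties using (∈-∃++; ∈-++⁻)
open import Data.List.Relation.Binary.Permutation.Propositional
  using (_↭_; prep; swap; ↭-refl; ↭-sym; ↭-trans; ↭-reflexive)
open import Data.List.Relation.Binary.Permutation.Propositional.Properties
  using (∈-resp-↭; All-resp-↭; drop-∷; shift; shifts; ++⁺ˡ; ++⁺ʳ; ++⁺; ↭-length;
         ↭-singleton-inv; map⁺; ++-commutativeMonoid; ∷↭∷ʳ)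
  renaming (++-comm to ++-comm-↭)
open import Relation.Binary.PropositionalEquality using (_≡_; refl; cong; subst; sym; trans)
open import Algebra.Solver.CommutativeMonoid (++-commutativeMonoid {A = Fm})
  using (solve; _⊜_; _⊕_)

infixr 5 _∙_
_∙_ : {a b c : List Fm} → a ↭ b → b ↭ c → a ↭ c
_∙_ = ↭-trans

∷-↭-∷ : ∀ {C D : Fm} {Δ₀ Δ₁} → C ∷ Δ₀ ↭ D ∷ Δ₁ →
        (C ≡ D × Δ₀ ↭ Δ₁) ⊎ (Σ (List Fm) λ Δ → Δ₀ ↭ D ∷ Δ × Δ₁ ↭ C ∷ Δ)
∷-↭-∷ {C} {D} p with ∈-resp-↭ (↭-sym p) (here refl)
... | here refl = inj₁ (refl , drop-∷ p)
... | there m with ∈-∃++ m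
... | h , t , refl = inj₂ (h ++ t , shift D h t ,
        drop-∷ (↭-sym p ∙ prep C (shift D h t) ∙ swap C D ↭-refl))

∷-↭-∷∷ : ∀ {C A : Fm} {G Γ} → C ∷ G ↭ A ∷ A ∷ Γ →
         (C ≡ A × G ↭ A ∷ Γ) ⊎ (Σ (List Fm) λ Γ′ → G ↭ A ∷ A ∷ Γ′ × Γ ↭ C ∷ Γ′)
∷-↭-∷∷ {C} {A} p with ∷-↭-∷ p
... | inj₁ (e , r) = inj₁ (e , r)
... | inj₂ (G₂ , r₁ , r₂) with ∷-↭-∷ r₂
...   | inj₁ (refl , r) = inj₁ (refl , r₁ ∙ prep A (↭-sym r))
...   | inj₂ (Γ′ , s₁ , s₂) = inj₂ (Γ′ , r₁ ∙ prep A s₂ , s₁)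

∷-↭-□* : ∀ L {x : Fm} {Γ G} → x ∷ Γ ↭ □* L ++ G →
  (Σ Fm λ B → Σ (List Fm) λ L′ → x ≡ □ B × L ↭ B ∷ L′ × Γ ↭ □* L′ ++ G) ⊎
  (Σ (List Fm) λ G′ → G ↭ x ∷ G′ × Γ ↭ □* L ++ G′)
∷-↭-□* [] {Γ = Γ} p = inj₂ (Γ , ↭-sym p , ↭-refl)
∷-↭-□* (A ∷ L) p with ∷-↭-∷ p
... | inj₁ (eq , q) = inj₁ (A , L , eq , ↭-refl , q)
... | inj₂ (Γ₂ , q₁ , q₂) with ∷-↭-□* L (↭-sym q₂)
...   | inj₁ (B , L′ , eq , r , s) =
          inj₁ (B , A ∷ L′ , eq , prep A r ∙ swap A B ↭-refl , q₁ ∙ prep (□ A) s)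
...   | inj₂ (G′ , r , s) = inj₂ (G′ , r , q₁ ∙ prep _ s)

∷-↭-++ : ∀ Π Ψ {B : Fm} {L′} → Π ++ Ψ ↭ B ∷ L′ →
  (Σ (List Fm) λ Π′ → Π ↭ B ∷ Π′ × L′ ↭ Π′ ++ Ψ) ⊎
  (Σ (List Fm) λ Ψ′ → Ψ ↭ B ∷ Ψ′ × L′ ↭ Π ++ Ψ′)
∷-↭-++ Π Ψ {B} p with ∈-++⁻ Π (∈-resp-↭ (↭-sym p) (here refl))
... | inj₁ m with ∈-∃++ m
...   | h , t , refl = inj₁ (h ++ t , shift B h t ,
          drop-∷ (↭-sym p ∙ ++⁺ʳ Ψ (shift B h t)))
∷-↭-++ Π Ψ {B} p | inj₂ m with ∈-∃++ m
...   | h , t , refl = inj₂ (h ++ t , shift B h t ,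
          drop-∷ (↭-sym p ∙ ++⁺ˡ Π (shift B h t) ∙ shift B Π (h ++ t)))

[x]-↭-∷ : ∀ {x y : Fm} {l} → x ∷ [] ↭ y ∷ l → x ≡ y × l ≡ []
[x]-↭-∷ p with ↭-singleton-inv (↭-sym p)
... | refl = refl , refl

[]-↭-∷ : ∀ {B : Fm} {L′} {Z : Set} → [] ↭ B ∷ L′ → Z
[]-↭-∷ p with ↭-length p
... | ()

≤1-↭-∷∷ : ∀ {R : List Fm} {x y l} → length R ≤ 1 → R ↭ x ∷ y ∷ l → ⊥
≤1-↭-∷∷ n p with subst (_≤ 1) (↭-length p) n
... | s≤s ()

prefix-∷ : ∀ Θ {Γ : List Fm} {x G} → Γ ↭ x ∷ G → Θ ++ Γ ↭ x ∷ Θ ++ G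
prefix-∷ Θ {x = x} {G} p = ++⁺ˡ Θ p ∙ shift x Θ G

prefix-++ : ∀ Θ M {Γ G : List Fm} → Γ ↭ M ++ G → Θ ++ Γ ↭ M ++ Θ ++ G
prefix-++ Θ M p = ++⁺ˡ Θ p ∙ shifts Θ M

suffix-++ : ∀ M {Γ G : List Fm} Π → Γ ↭ M ++ G → Γ ++ Π ↭ M ++ G ++ Π
suffix-++ M {G = G} Π p = ++⁺ʳ Π p ∙ ↭-reflexive (List.++-assoc M G Π)

drop-second : ∀ {Q : Fm → Set} {x y l} → All Q (x ∷ y ∷ l) → All Q (x ∷ l)
drop-second (px ∷ _ ∷ pl) = px ∷ pl

All-transpose : ∀ {P : Fm → Fm → Set} {Π Ψ} →
                All (λ A → All (P A) Ψ) Π → All (λ B → All (λ A → P A B) Π) Ψ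
All-transpose {Ψ = Ψ} [] = All.universal (λ _ → []) Ψ
All-transpose (row ∷ rows) = All.zipWith (λ (p , ps) → p ∷ ps) (row , All-transpose rows)

□*-++ : ∀ Π Ψ (G : List Fm) → □* Π ++ □* Ψ ++ G ↭ □* (Π ++ Ψ) ++ G
□*-++ Π Ψ G = ↭-reflexive (sym (trans (cong (_++ G) (List.map-++ □ Π Ψ))
                                      (List.++-assoc (□* Π) (□* Ψ) G)))

-- Facts about which rules share a calculus are checked by evaluating `has`:
-- `Everywhere f` says that the Boolean property f holds in all 22 calculi;
-- for a closed f each component reduces to ⊤, so its proof is `_`.
Everywhere : (Calc → Bool) → Set
Everywhere f =
  T (f G3E) × T (f G3EN) × T (f G3M) × T (f G3MN) × T (f G3C) × T (f G3CN) ×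
  T (f G3R) × T (f G3K) × T (f G3ED⊥) × T (f G3END⊥) × T (f G3ED◇) ×
  T (f G3ED) × T (f G3END) × T (f G3MD⊥) × T (f G3MND⊥) × T (f G3MD) ×
  T (f G3MND) × T (f G3CD◇) × T (f G3CD) × T (f G3CND) × T (f G3RD) × T (f G3KD)

everywhere : ∀ f → Everywhere f → ∀ X → T (f X)
everywhere f (p , _) G3E = p
everywhere f (_ , p , _) G3EN = p
everywhere f (_ , _ , p , _) G3M = p
everywhere f (_ , _ , _ , p , _) G3MN = p
everywhere f (_ , _ , _ , _ , p , _) G3C = p
everywhere f (_ , _ , _ , _ , _ , p , _) G3CN = p
everywhere f (_ , _ , _ , _ , _ , _ , p , _) G3R = p
everywhere f (_ , _ , _ , _ , _ , _ , _ , p , _) G3K = p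
everywhere f (_ , _ , _ , _ , _ , _ , _ , _ , p , _) G3ED⊥ = p
everywhere f (_ , _ , _ , _ , _ , _ , _ , _ , _ , p , _) G3END⊥ = p
everywhere f (_ , _ , _ , _ , _ , _ , _ , _ , _ , _ , p , _) G3ED◇ = p
everywhere f (_ , _ , _ , _ , _ , _ , _ , _ , _ , _ , _ , p , _) G3ED = p
everywhere f (_ , _ , _ , _ , _ , _ , _ , _ , _ , _ , _ , _ , p , _) G3END = p
everywhere f (_ , _ , _ , _ , _ , _ , _ , _ , _ , _ , _ , _ , _ , p , _) G3MD⊥ = p
everywhere f (_ , _ , _ , _ , _ , _ , _ , _ , _ , _ , _ , _ , _ , _ , p , _) G3MND⊥ = p
everywhere f (_ , _ , _ , _ , _ , _ , _ , _ , _ , _ , _ , _ , _ , _ , _ , p , _) G3MD = p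
everywhere f (_ , _ , _ , _ , _ , _ , _ , _ , _ , _ , _ , _ , _ , _ , _ , _ , p , _) G3MND = p
everywhere f (_ , _ , _ , _ , _ , _ , _ , _ , _ , _ , _ , _ , _ , _ , _ , _ , _ , p , _) G3CD◇ = p
everywhere f (_ , _ , _ , _ , _ , _ , _ , _ , _ , _ , _ , _ , _ , _ , _ , _ , _ , _ , p , _) G3CD = p
everywhere f (_ , _ , _ , _ , _ , _ , _ , _ , _ , _ , _ , _ , _ , _ , _ , _ , _ , _ , _ , p , _) G3CND = p
everywhere f (_ , _ , _ , _ , _ , _ , _ , _ , _ , _ , _ , _ , _ , _ , _ , _ , _ , _ , _ , _ , p , _) G3RD = p
everywhere f (_ , _ , _ , _ , _ , _ , _ , _ , _ , _ , _ , _ , _ , _ , _ , _ , _ , _ , _ , _ , _ , p) G3KD = p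

exclusive : ∀ {X} r₁ r₂ → Everywhere (λ Y → not (has Y r₁ ∧ has Y r₂)) →
            T (has X r₁) → T (has X r₂) → ⊥
exclusive {X} r₁ r₂ w = not-both (has X r₁) (has X r₂)
                          (everywhere (λ Y → not (has Y r₁ ∧ has Y r₂)) w X)
  where
  not-both : ∀ a b → T (not (a ∧ b)) → T a → T b → ⊥
  not-both true true () _ _

entails : ∀ {X} r₁ r₂ r₃ → Everywhere (λ Y → not (has Y r₁ ∧ has Y r₂) ∨ has Y r₃) →
          T (has X r₁) → T (has X r₂) → T (has X r₃)
entails {X} r₁ r₂ r₃ w = modus-ponens (has X r₁) (has X r₂) (has X r₃)
                           (everywhere (λ Y → not (has Y r₁ ∧ has Y r₂) ∨ has Y r₃) w X)
  where
  modus-ponens : ∀ a b c → T (not (a ∧ b) ∨ c) → T a → T b → T c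
  modus-ponens true true true _ _ _ = tt

module CutAdmissibility (X : Calc) where

  -- Derivations in X with the modal and deontic rules merged into one rule
  -- `modal`.
  infix 4 _⟹_
  data _⟹_ : List Fm → List Fm → Set
  data ModalStep : List Fm → List Fm → Set

  data ModalStep where
    by-E   : T (has X LR-E) → ∀ A B → A ∷ [] ⟹ B ∷ [] → B ∷ [] ⟹ A ∷ [] →
             ModalStep (A ∷ []) (B ∷ [])
    by-M   : T (has X LR-M) → ∀ A B → A ∷ [] ⟹ B ∷ [] → ModalStep (A ∷ []) (B ∷ [])
    by-R   : T (has X LR-R) → ∀ A Π B → A ∷ Π ⟹ B ∷ [] → ModalStep (A ∷ Π) (B ∷ [])
    by-C   : T (has X LR-C) → ∀ A As B → A ∷ As ⟹ B ∷ [] →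
             All (λ C → B ∷ [] ⟹ C ∷ []) (A ∷ As) → ModalStep (A ∷ As) (B ∷ [])
    by-K   : T (has X LR-K) → ∀ Π B → Π ⟹ B ∷ [] → ModalStep Π (B ∷ [])
    by-N   : T (has X R-N) → ∀ B → [] ⟹ B ∷ [] → ModalStep [] (B ∷ [])
    by-D⊥  : T (has X L-D⊥) → ∀ A → A ∷ [] ⟹ [] → ModalStep (A ∷ []) []
    by-D◇E : T (has X L-D◇E) → ∀ Π → length Π ≤ 2 → Π ⟹ [] → [] ⟹ Π → ModalStep Π []
    by-D◇M : T (has X L-D◇M) → ∀ Π → length Π ≤ 2 → Π ⟹ [] → ModalStep Π []
    by-D◇C : T (has X L-D◇C) → ∀ Π Ψ → Π ++ Ψ ⟹ [] →
             All (λ A → All (λ B → [] ⟹ A ∷ B ∷ []) Ψ) Π → ModalStep (Π ++ Ψ) []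
    by-D*  : T (has X L-D*) → ∀ Π → Π ⟹ [] → ModalStep Π []

  data _⟹_ where
    init  : ∀ {Γ' Δ'} p Γ Δ → Γ' ↭ var p ∷ Γ → Δ' ↭ var p ∷ Δ → Γ' ⟹ Δ'
    L⊥    : ∀ {Γ' Δ} Γ → Γ' ↭ ⊥' ∷ Γ → Γ' ⟹ Δ
    L∧    : ∀ {Γ' Δ} A B Γ → Γ' ↭ A ∧' B ∷ Γ → A ∷ B ∷ Γ ⟹ Δ → Γ' ⟹ Δ
    R∧    : ∀ {Γ Δ'} A B Δ → Δ' ↭ A ∧' B ∷ Δ → Γ ⟹ A ∷ Δ → Γ ⟹ B ∷ Δ → Γ ⟹ Δ'
    L∨    : ∀ {Γ' Δ} A B Γ → Γ' ↭ A ∨' B ∷ Γ → A ∷ Γ ⟹ Δ → B ∷ Γ ⟹ Δ → Γ' ⟹ Δ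
    R∨    : ∀ {Γ Δ'} A B Δ → Δ' ↭ A ∨' B ∷ Δ → Γ ⟹ A ∷ B ∷ Δ → Γ ⟹ Δ'
    L⊃    : ∀ {Γ' Δ} A B Γ → Γ' ↭ A ⊃ B ∷ Γ → Γ ⟹ A ∷ Δ → B ∷ Γ ⟹ Δ → Γ' ⟹ Δ
    R⊃    : ∀ {Γ Δ'} A B Δ → Δ' ↭ A ⊃ B ∷ Δ → A ∷ Γ ⟹ B ∷ Δ → Γ ⟹ Δ'
    modal : ∀ {L R G D Γ Δ} → ModalStep L R → Γ ↭ □* L ++ G → Δ ↭ □* R ++ D → Γ ⟹ Δ

  embed : ∀ {Γ Δ} → X ⊢ Γ ⇒ Δ → Γ ⟹ Δ
  embed-All : ∀ {P Q : Fm → List Fm} {L} →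
              All (λ C → X ⊢ P C ⇒ Q C) L → All (λ C → P C ⟹ Q C) L
  embed-All² : ∀ {Π Ψ} → All (λ A → All (λ B → X ⊢ [] ⇒ A ∷ B ∷ []) Ψ) Π →
               All (λ A → All (λ B → [] ⟹ A ∷ B ∷ []) Ψ) Π

  embed (init p Γ Δ e f) = init p Γ Δ e f
  embed (L⊥ Γ e) = L⊥ Γ e
  embed (L∧ A B Γ e d) = L∧ A B Γ e (embed d)
  embed (R∧ A B Δ f d₁ d₂) = R∧ A B Δ f (embed d₁) (embed d₂)
  embed (L∨ A B Γ e d₁ d₂) = L∨ A B Γ e (embed d₁) (embed d₂)
  embed (R∨ A B Δ f d) = R∨ A B Δ f (embed d)
  embed (L⊃ A B Γ e d₁ d₂) = L⊃ A B Γ e (embed d₁) (embed d₂)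
  embed (R⊃ A B Δ f d) = R⊃ A B Δ f (embed d)
  embed (lr-E t A B Γ Δ e f d₁ d₂) = modal (by-E t A B (embed d₁) (embed d₂)) e f
  embed (lr-M t A B Γ Δ e f d) = modal (by-M t A B (embed d)) e f
  embed (lr-R t A Π B Γ Δ e f d) = modal (by-R t A Π B (embed d)) e f
  embed (lr-C t A As B Γ Δ e f d ds) = modal (by-C t A As B (embed d) (embed-All ds)) e f
  embed (lr-K t Π B Γ Δ e f d) = modal (by-K t Π B (embed d)) e f
  embed (r-N t B Δ f d) = modal (by-N t B (embed d)) ↭-refl f
  embed (l-D⊥ t A Γ e d) = modal (by-D⊥ t A (embed d)) e ↭-refl
  embed (l-D◇E t Π Γ n e d₁ d₂) = modal (by-D◇E t Π n (embed d₁) (embed d₂)) e ↭-refl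
  embed (l-D◇M t Π Γ n e d) = modal (by-D◇M t Π n (embed d)) e ↭-refl
  embed (l-D◇C t Π Ψ Γ e d ds) =
    modal (by-D◇C t Π Ψ (embed d) (embed-All² ds)) (e ∙ □*-++ Π Ψ Γ) ↭-refl
  embed (l-D* t Π Γ e d) = modal (by-D* t Π (embed d)) e ↭-refl

  embed-All [] = []
  embed-All (d ∷ ds) = embed d ∷ embed-All ds
  embed-All² [] = []
  embed-All² (ds ∷ dss) = embed-All ds ∷ embed-All² dss

  extract : ∀ {Γ Δ} → Γ ⟹ Δ → X ⊢ Γ ⇒ Δ
  extract-All : ∀ {P Q : Fm → List Fm} {L} →
                All (λ C → P C ⟹ Q C) L → All (λ C → X ⊢ P C ⇒ Q C) L
  extract-All² : ∀ {Π Ψ} → All (λ A → All (λ B → [] ⟹ A ∷ B ∷ []) Ψ) Π →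
                 All (λ A → All (λ B → X ⊢ [] ⇒ A ∷ B ∷ []) Ψ) Π
  extract-modal : ∀ {L R G D Γ Δ} → ModalStep L R →
                  Γ ↭ □* L ++ G → Δ ↭ □* R ++ D → X ⊢ Γ ⇒ Δ

  extract (init p Γ Δ e f) = init p Γ Δ e f
  extract (L⊥ Γ e) = L⊥ Γ e
  extract (L∧ A B Γ e d) = L∧ A B Γ e (extract d)
  extract (R∧ A B Δ f d₁ d₂) = R∧ A B Δ f (extract d₁) (extract d₂)
  extract (L∨ A B Γ e d₁ d₂) = L∨ A B Γ e (extract d₁) (extract d₂)
  extract (R∨ A B Δ f d) = R∨ A B Δ f (extract d)
  extract (L⊃ A B Γ e d₁ d₂) = L⊃ A B Γ e (extract d₁) (extract d₂)
  extract (R⊃ A B Δ f d) = R⊃ A B Δ f (extract d)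
  extract (modal s e f) = extract-modal s e f

  extract-modal (by-E t A B d₁ d₂) e f = lr-E t A B _ _ e f (extract d₁) (extract d₂)
  extract-modal (by-M t A B d) e f = lr-M t A B _ _ e f (extract d)
  extract-modal (by-R t A Π B d) e f = lr-R t A Π B _ _ e f (extract d)
  extract-modal (by-C t A As B d ds) e f = lr-C t A As B _ _ e f (extract d) (extract-All ds)
  extract-modal (by-K t Π B d) e f = lr-K t Π B _ _ e f (extract d)
  extract-modal (by-N t B d) e f = r-N t B _ f (extract d)
  extract-modal (by-D⊥ t A d) e f = l-D⊥ t A _ e (extract d)
  extract-modal (by-D◇E t Π n d₁ d₂) e f = l-D◇E t Π _ n e (extract d₁) (extract d₂)
  extract-modal (by-D◇M t Π n d) e f = l-D◇M t Π _ n e (extract d)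
  extract-modal {G = G} (by-D◇C t Π Ψ d ds) e f =
    l-D◇C t Π Ψ G (e ∙ ↭-sym (□*-++ Π Ψ G)) (extract d) (extract-All² ds)
  extract-modal (by-D* t Π d) e f = l-D* t Π _ e (extract d)

  extract-All [] = []
  extract-All (d ∷ ds) = extract d ∷ extract-All ds
  extract-All² [] = []
  extract-All² (ds ∷ dss) = extract-All ds ∷ extract-All² dss

  succedent-≤1 : ∀ {L R} → ModalStep L R → length R ≤ 1
  succedent-≤1 (by-E _ _ _ _ _) = s≤s z≤n
  succedent-≤1 (by-M _ _ _ _) = s≤s z≤n
  succedent-≤1 (by-R _ _ _ _ _) = s≤s z≤n
  succedent-≤1 (by-C _ _ _ _ _ _) = s≤s z≤n
  succedent-≤1 (by-K _ _ _ _) = s≤s z≤n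
  succedent-≤1 (by-N _ _ _) = s≤s z≤n
  succedent-≤1 (by-D⊥ _ _ _) = z≤n
  succedent-≤1 (by-D◇E _ _ _ _ _) = z≤n
  succedent-≤1 (by-D◇M _ _ _ _) = z≤n
  succedent-≤1 (by-D◇C _ _ _ _ _) = z≤n
  succedent-≤1 (by-D* _ _ _) = z≤n

  exchange : ∀ {Γ Δ Γ′ Δ′} → Γ ↭ Γ′ → Δ ↭ Δ′ → Γ ⟹ Δ → Γ′ ⟹ Δ′
  exchange g h (init p G D e f) = init p G D (↭-sym g ∙ e) (↭-sym h ∙ f)
  exchange g h (L⊥ G e) = L⊥ G (↭-sym g ∙ e)
  exchange g h (L∧ A B G e d) = L∧ A B G (↭-sym g ∙ e) (exchange ↭-refl h d)
  exchange g h (R∧ A B D f d₁ d₂) =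
    R∧ A B D (↭-sym h ∙ f) (exchange g ↭-refl d₁) (exchange g ↭-refl d₂)
  exchange g h (L∨ A B G e d₁ d₂) =
    L∨ A B G (↭-sym g ∙ e) (exchange ↭-refl h d₁) (exchange ↭-refl h d₂)
  exchange g h (R∨ A B D f d) = R∨ A B D (↭-sym h ∙ f) (exchange g ↭-refl d)
  exchange g h (L⊃ A B G e d₁ d₂) =
    L⊃ A B G (↭-sym g ∙ e) (exchange ↭-refl (prep A h) d₁) (exchange ↭-refl h d₂)
  exchange g h (R⊃ A B D f d) = R⊃ A B D (↭-sym h ∙ f) (exchange (prep A g) ↭-refl d)
  exchange g h (modal s e f) = modal s (↭-sym g ∙ e) (↭-sym h ∙ f)

  exchangeˡ : ∀ {Γ Δ Γ′} → Γ ↭ Γ′ → Γ ⟹ Δ → Γ′ ⟹ Δ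
  exchangeˡ g = exchange g ↭-refl

  exchangeʳ : ∀ {Γ Δ Δ′} → Δ ↭ Δ′ → Γ ⟹ Δ → Γ ⟹ Δ′
  exchangeʳ h = exchange ↭-refl h

  weaken : ∀ Θ Λ {Γ Δ} → Γ ⟹ Δ → Θ ++ Γ ⟹ Λ ++ Δ
  weaken Θ Λ (init p G D e f) = init p (Θ ++ G) (Λ ++ D) (prefix-∷ Θ e) (prefix-∷ Λ f)
  weaken Θ Λ (L⊥ G e) = L⊥ (Θ ++ G) (prefix-∷ Θ e)
  weaken Θ Λ (L∧ A B G e d) =
    L∧ A B (Θ ++ G) (prefix-∷ Θ e) (exchangeˡ (shifts Θ (A ∷ B ∷ [])) (weaken Θ Λ d))
  weaken Θ Λ (R∧ A B D f d₁ d₂) = R∧ A B (Λ ++ D) (prefix-∷ Λ f)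
    (exchangeʳ (shift A Λ D) (weaken Θ Λ d₁)) (exchangeʳ (shift B Λ D) (weaken Θ Λ d₂))
  weaken Θ Λ (L∨ A B G e d₁ d₂) = L∨ A B (Θ ++ G) (prefix-∷ Θ e)
    (exchangeˡ (shift A Θ G) (weaken Θ Λ d₁)) (exchangeˡ (shift B Θ G) (weaken Θ Λ d₂))
  weaken Θ Λ (R∨ A B D f d) =
    R∨ A B (Λ ++ D) (prefix-∷ Λ f) (exchangeʳ (shifts Λ (A ∷ B ∷ [])) (weaken Θ Λ d))
  weaken Θ Λ (L⊃ A B G e d₁ d₂) = L⊃ A B (Θ ++ G) (prefix-∷ Θ e)
    (exchangeʳ (shift A Λ _) (weaken Θ Λ d₁)) (exchangeˡ (shift B Θ G) (weaken Θ Λ d₂))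
  weaken Θ Λ (R⊃ A B D f d) = R⊃ A B (Λ ++ D) (prefix-∷ Λ f)
    (exchange (shift A Θ _) (shift B Λ D) (weaken Θ Λ d))
  weaken Θ Λ (modal {L} {R} s e f) = modal s (prefix-++ Θ (□* L) e) (prefix-++ Λ (□* R) f)

  FromLeftPremisses : Fm → List Fm → List Fm → Set
  FromLeftPremisses (A ∧' B) Θ Λ =
    ∀ {Γ Δ} → A ∷ B ∷ Γ ⟹ Δ → Θ ++ Γ ⟹ Λ ++ Δ
  FromLeftPremisses (A ∨' B) Θ Λ =
    ∀ {Γ Δ} → A ∷ Γ ⟹ Δ → B ∷ Γ ⟹ Δ → Θ ++ Γ ⟹ Λ ++ Δ
  FromLeftPremisses (A ⊃ B) Θ Λ =
    ∀ {Γ Δ} → Γ ⟹ A ∷ Δ → B ∷ Γ ⟹ Δ → Θ ++ Γ ⟹ Λ ++ Δ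
  FromLeftPremisses _ _ _ = ⊥

  FromRightPremisses : Fm → List Fm → List Fm → Set
  FromRightPremisses (A ∧' B) Θ Λ =
    ∀ {Γ Δ} → Γ ⟹ A ∷ Δ → Γ ⟹ B ∷ Δ → Θ ++ Γ ⟹ Λ ++ Δ
  FromRightPremisses (A ∨' B) Θ Λ =
    ∀ {Γ Δ} → Γ ⟹ A ∷ B ∷ Δ → Θ ++ Γ ⟹ Λ ++ Δ
  FromRightPremisses (A ⊃ B) Θ Λ =
    ∀ {Γ Δ} → A ∷ Γ ⟹ B ∷ Δ → Θ ++ Γ ⟹ Λ ++ Δ
  FromRightPremisses _ _ _ = ⊥

  -- Hence a derivation of C, Γ ⇒ Δ yields Θ, Γ ⇒ Λ, Δ: where C is principal
  -- the hypothesis applies; every other rule, including a modal step (which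
  -- never has C principal), commutes with the transformation.
  invertˡ : ∀ C Θ Λ {Γ′ Γ Δ} → FromLeftPremisses C Θ Λ →
            Γ′ ⟹ Δ → Γ′ ↭ C ∷ Γ → Θ ++ Γ ⟹ Λ ++ Δ
  invertˡ C Θ Λ h (init p G D e f) q with ∷-↭-∷ (↭-sym e ∙ q)
  ... | inj₁ (refl , _) = ⊥-elim h
  ... | inj₂ (G₂ , _ , r₂) = init p (Θ ++ G₂) (Λ ++ D) (prefix-∷ Θ r₂) (prefix-∷ Λ f)
  invertˡ C Θ Λ h (L⊥ G e) q with ∷-↭-∷ (↭-sym e ∙ q)
  ... | inj₁ (refl , _) = ⊥-elim h
  ... | inj₂ (G₂ , _ , r₂) = L⊥ (Θ ++ G₂) (prefix-∷ Θ r₂)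
  invertˡ C Θ Λ h (L∧ A B G e d) q with ∷-↭-∷ (↭-sym e ∙ q)
  ... | inj₁ (refl , r) = h (exchangeˡ (prep A (prep B r)) d)
  ... | inj₂ (G₂ , r₁ , r₂) = L∧ A B (Θ ++ G₂) (prefix-∷ Θ r₂)
          (exchangeˡ (shifts Θ (A ∷ B ∷ []))
            (invertˡ C Θ Λ h d (prep A (prep B r₁) ∙ shifts (A ∷ B ∷ []) (C ∷ []))))
  invertˡ C Θ Λ h (L∨ A B G e d₁ d₂) q with ∷-↭-∷ (↭-sym e ∙ q)
  ... | inj₁ (refl , r) = h (exchangeˡ (prep A r) d₁) (exchangeˡ (prep B r) d₂)
  ... | inj₂ (G₂ , r₁ , r₂) = L∨ A B (Θ ++ G₂) (prefix-∷ Θ r₂)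
          (exchangeˡ (shift A Θ G₂) (invertˡ C Θ Λ h d₁ (prep A r₁ ∙ swap A C ↭-refl)))
          (exchangeˡ (shift B Θ G₂) (invertˡ C Θ Λ h d₂ (prep B r₁ ∙ swap B C ↭-refl)))
  invertˡ C Θ Λ h (L⊃ A B G e d₁ d₂) q with ∷-↭-∷ (↭-sym e ∙ q)
  ... | inj₁ (refl , r) = h (exchangeˡ r d₁) (exchangeˡ (prep B r) d₂)
  ... | inj₂ (G₂ , r₁ , r₂) = L⊃ A B (Θ ++ G₂) (prefix-∷ Θ r₂)
          (exchangeʳ (shift A Λ _) (invertˡ C Θ Λ h d₁ r₁))
          (exchangeˡ (shift B Θ G₂) (invertˡ C Θ Λ h d₂ (prep B r₁ ∙ swap B C ↭-refl)))
  invertˡ C Θ Λ h (R∧ A B D f d₁ d₂) q = R∧ A B (Λ ++ D) (prefix-∷ Λ f)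
          (exchangeʳ (shift A Λ D) (invertˡ C Θ Λ h d₁ q))
          (exchangeʳ (shift B Λ D) (invertˡ C Θ Λ h d₂ q))
  invertˡ C Θ Λ h (R∨ A B D f d) q = R∨ A B (Λ ++ D) (prefix-∷ Λ f)
          (exchangeʳ (shifts Λ (A ∷ B ∷ [])) (invertˡ C Θ Λ h d q))
  invertˡ C Θ Λ h (R⊃ A B D f d) q = R⊃ A B (Λ ++ D) (prefix-∷ Λ f)
          (exchange (shift A Θ _) (shift B Λ D) (invertˡ C Θ Λ h d (prep A q ∙ swap A C ↭-refl)))
  invertˡ C Θ Λ h (modal {L} {R} s e f) q with ∷-↭-□* L (↭-sym q ∙ e)
  ... | inj₁ (_ , _ , refl , _ , _) = ⊥-elim h
  ... | inj₂ (_ , _ , r) = modal s (prefix-++ Θ (□* L) r) (prefix-++ Λ (□* R) f)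

  invertʳ : ∀ C Θ Λ {Γ Δ′ Δ} → FromRightPremisses C Θ Λ →
            Γ ⟹ Δ′ → Δ′ ↭ C ∷ Δ → Θ ++ Γ ⟹ Λ ++ Δ
  invertʳ C Θ Λ h (init p G D e f) q with ∷-↭-∷ (↭-sym f ∙ q)
  ... | inj₁ (refl , _) = ⊥-elim h
  ... | inj₂ (D₂ , _ , r₂) = init p (Θ ++ G) (Λ ++ D₂) (prefix-∷ Θ e) (prefix-∷ Λ r₂)
  invertʳ C Θ Λ h (L⊥ G e) q = L⊥ (Θ ++ G) (prefix-∷ Θ e)
  invertʳ C Θ Λ h (L∧ A B G e d) q = L∧ A B (Θ ++ G) (prefix-∷ Θ e)
          (exchangeˡ (shifts Θ (A ∷ B ∷ [])) (invertʳ C Θ Λ h d q))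
  invertʳ C Θ Λ h (L∨ A B G e d₁ d₂) q = L∨ A B (Θ ++ G) (prefix-∷ Θ e)
          (exchangeˡ (shift A Θ G) (invertʳ C Θ Λ h d₁ q))
          (exchangeˡ (shift B Θ G) (invertʳ C Θ Λ h d₂ q))
  invertʳ C Θ Λ h (L⊃ A B G e d₁ d₂) q = L⊃ A B (Θ ++ G) (prefix-∷ Θ e)
          (exchangeʳ (shift A Λ _) (invertʳ C Θ Λ h d₁ (prep A q ∙ swap A C ↭-refl)))
          (exchangeˡ (shift B Θ G) (invertʳ C Θ Λ h d₂ q))
  invertʳ C Θ Λ h (R∧ A B D f d₁ d₂) q with ∷-↭-∷ (↭-sym f ∙ q)
  ... | inj₁ (refl , r) = h (exchangeʳ (prep A r) d₁) (exchangeʳ (prep B r) d₂)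
  ... | inj₂ (D₂ , r₁ , r₂) = R∧ A B (Λ ++ D₂) (prefix-∷ Λ r₂)
          (exchangeʳ (shift A Λ D₂) (invertʳ C Θ Λ h d₁ (prep A r₁ ∙ swap A C ↭-refl)))
          (exchangeʳ (shift B Λ D₂) (invertʳ C Θ Λ h d₂ (prep B r₁ ∙ swap B C ↭-refl)))
  invertʳ C Θ Λ h (R∨ A B D f d) q with ∷-↭-∷ (↭-sym f ∙ q)
  ... | inj₁ (refl , r) = h (exchangeʳ (prep A (prep B r)) d)
  ... | inj₂ (D₂ , r₁ , r₂) = R∨ A B (Λ ++ D₂) (prefix-∷ Λ r₂)
          (exchangeʳ (shifts Λ (A ∷ B ∷ []))
            (invertʳ C Θ Λ h d (prep A (prep B r₁) ∙ shifts (A ∷ B ∷ []) (C ∷ []))))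
  invertʳ C Θ Λ h (R⊃ A B D f d) q with ∷-↭-∷ (↭-sym f ∙ q)
  ... | inj₁ (refl , r) = h (exchangeʳ (prep B r) d)
  ... | inj₂ (D₂ , r₁ , r₂) = R⊃ A B (Λ ++ D₂) (prefix-∷ Λ r₂)
          (exchange (shift A Θ _) (shift B Λ D₂) (invertʳ C Θ Λ h d (prep B r₁ ∙ swap B C ↭-refl)))
  invertʳ C Θ Λ h (modal {L} {R} s e f) q with ∷-↭-□* R (↭-sym q ∙ f)
  ... | inj₁ (_ , _ , refl , _ , _) = ⊥-elim h
  ... | inj₂ (_ , _ , r) = modal s (prefix-++ Θ (□* L) e) (prefix-++ Λ (□* R) r)

  L∧⁻ : ∀ {A B Γ′ Γ Δ} → Γ′ ⟹ Δ → Γ′ ↭ A ∧' B ∷ Γ → A ∷ B ∷ Γ ⟹ Δ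
  L∧⁻ {A} {B} = invertˡ (A ∧' B) (A ∷ B ∷ []) [] (λ d → d)

  L∨⁻₁ : ∀ {A B Γ′ Γ Δ} → Γ′ ⟹ Δ → Γ′ ↭ A ∨' B ∷ Γ → A ∷ Γ ⟹ Δ
  L∨⁻₁ {A} {B} = invertˡ (A ∨' B) (A ∷ []) [] (λ d₁ _ → d₁)

  L∨⁻₂ : ∀ {A B Γ′ Γ Δ} → Γ′ ⟹ Δ → Γ′ ↭ A ∨' B ∷ Γ → B ∷ Γ ⟹ Δ
  L∨⁻₂ {A} {B} = invertˡ (A ∨' B) (B ∷ []) [] (λ _ d₂ → d₂)

  L⊃⁻₁ : ∀ {A B Γ′ Γ Δ} → Γ′ ⟹ Δ → Γ′ ↭ A ⊃ B ∷ Γ → Γ ⟹ A ∷ Δ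
  L⊃⁻₁ {A} {B} = invertˡ (A ⊃ B) [] (A ∷ []) (λ d₁ _ → d₁)

  L⊃⁻₂ : ∀ {A B Γ′ Γ Δ} → Γ′ ⟹ Δ → Γ′ ↭ A ⊃ B ∷ Γ → B ∷ Γ ⟹ Δ
  L⊃⁻₂ {A} {B} = invertˡ (A ⊃ B) (B ∷ []) [] (λ _ d₂ → d₂)

  R∧⁻₁ : ∀ {A B Γ Δ′ Δ} → Γ ⟹ Δ′ → Δ′ ↭ A ∧' B ∷ Δ → Γ ⟹ A ∷ Δ
  R∧⁻₁ {A} {B} = invertʳ (A ∧' B) [] (A ∷ []) (λ d₁ _ → d₁)

  R∧⁻₂ : ∀ {A B Γ Δ′ Δ} → Γ ⟹ Δ′ → Δ′ ↭ A ∧' B ∷ Δ → Γ ⟹ B ∷ Δ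
  R∧⁻₂ {A} {B} = invertʳ (A ∧' B) [] (B ∷ []) (λ _ d₂ → d₂)

  R∨⁻ : ∀ {A B Γ Δ′ Δ} → Γ ⟹ Δ′ → Δ′ ↭ A ∨' B ∷ Δ → Γ ⟹ A ∷ B ∷ Δ
  R∨⁻ {A} {B} = invertʳ (A ∨' B) [] (A ∷ B ∷ []) (λ d → d)

  R⊃⁻ : ∀ {A B Γ Δ′ Δ} → Γ ⟹ Δ′ → Δ′ ↭ A ⊃ B ∷ Δ → A ∷ Γ ⟹ B ∷ Δ
  R⊃⁻ {A} {B} = invertʳ (A ⊃ B) (A ∷ []) (B ∷ []) (λ d → d)

  Contractˡ : Fm → Set
  Contractˡ E = ∀ {Γ′ Γ Δ} → Γ′ ⟹ Δ → Γ′ ↭ E ∷ E ∷ Γ → E ∷ Γ ⟹ Δ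

  Contractʳ : Fm → Set
  Contractʳ E = ∀ {Γ Δ′ Δ} → Γ ⟹ Δ′ → Δ′ ↭ E ∷ E ∷ Δ → Γ ⟹ E ∷ Δ

  -- The contractions on immediate subformulas that contracting a formula on
  -- the left (right) relies on: those used when both copies are principal,
  -- after inversion, and for □A contraction of A in the premisses of a
  -- modal step (on both sides, because of D◇E).
  Contractˡ-below : Fm → Set
  Contractˡ-below (A ∧' B) = Contractˡ A × Contractˡ B
  Contractˡ-below (A ∨' B) = Contractˡ A × Contractˡ B
  Contractˡ-below (A ⊃ B) = Contractʳ A × Contractˡ B
  Contractˡ-below (□ A) = Contractˡ A × Contractʳ A
  Contractˡ-below _ = ⊤

  Contractʳ-below : Fm → Set
  Contractʳ-below (A ∧' B) = Contractʳ A × Contractʳ B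
  Contractʳ-below (A ∨' B) = Contractʳ A × Contractʳ B
  Contractʳ-below (A ⊃ B) = Contractˡ A × Contractʳ B
  Contractʳ-below _ = ⊤

  -- Removing one of two occurrences of E from the principal formulas Π, Ψ of a
  -- D◇C step keeps the side condition (it only quantifies over Π × Ψ).
  D◇C-drop-duplicate : ∀ {P : Fm → Fm → Set} {E L} Π Ψ → All (λ A → All (P A) Ψ) Π →
    Π ++ Ψ ↭ E ∷ E ∷ L →
    Σ (List Fm) λ Π′ → Σ (List Fm) λ Ψ′ → (Π′ ++ Ψ′ ↭ E ∷ L) × All (λ A → All (P A) Ψ′) Π′
  D◇C-drop-duplicate {E = E} Π Ψ a p with ∷-↭-++ Π Ψ p
  ... | inj₁ (Π₁ , s₁ , s₂) with ∷-↭-++ Π₁ Ψ (↭-sym s₂)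
  ...   | inj₁ (Π₂ , u₁ , u₂) = E ∷ Π₂ , Ψ , prep E (↭-sym u₂) ,
            drop-second (All-resp-↭ (s₁ ∙ prep E u₁) a)
  ...   | inj₂ (Ψ₁ , u₁ , u₂) = Π , Ψ₁ , ++⁺ʳ Ψ₁ s₁ ∙ prep E (↭-sym u₂) ,
            All.map (λ row → All.tail (All-resp-↭ u₁ row)) a
  D◇C-drop-duplicate {E = E} Π Ψ a p | inj₂ (Ψ₁ , s₁ , s₂) with ∷-↭-++ Π Ψ₁ (↭-sym s₂)
  ...   | inj₁ (Π₁ , u₁ , u₂) = Π , Ψ₁ , ++⁺ʳ Ψ₁ u₁ ∙ prep E (↭-sym u₂) ,
            All.map (λ row → All.tail (All-resp-↭ s₁ row)) a
  ...   | inj₂ (Ψ₂ , u₁ , u₂) = Π , E ∷ Ψ₂ , shift E Π Ψ₂ ∙ prep E (↭-sym u₂) ,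
            All.map (λ row → drop-second (All-resp-↭ (s₁ ∙ prep E u₁) row)) a

  contract-modal : ∀ {E L″ L R} → Contractˡ E → Contractʳ E → ModalStep L R →
                   L ↭ E ∷ E ∷ L″ → Σ (List Fm) λ L′ → L′ ↭ E ∷ L″ × ModalStep L′ R
  contract-modal cl cr (by-E _ _ _ _ _) p with ↭-length p
  ... | ()
  contract-modal cl cr (by-M _ _ _ _) p with ↭-length p
  ... | ()
  contract-modal cl cr (by-D⊥ _ _ _) p with ↭-length p
  ... | ()
  contract-modal cl cr (by-N _ _ _) p with ↭-length p
  ... | ()
  contract-modal {E} {L″} cl cr (by-R t _ _ B d) p =
    E ∷ L″ , ↭-refl , by-R t E L″ B (cl d p)
  contract-modal {E} {L″} cl cr (by-C t _ _ B d ds) p =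
    E ∷ L″ , ↭-refl , by-C t E L″ B (cl d p) (All.tail (All-resp-↭ p ds))
  contract-modal {E} {L″} cl cr (by-K t _ B d) p =
    E ∷ L″ , ↭-refl , by-K t (E ∷ L″) B (cl d p)
  contract-modal {E} {L″} cl cr (by-D◇E t _ n d₁ d₂) p = E ∷ L″ , ↭-refl ,
    by-D◇E t (E ∷ L″) (≤-trans (n≤1+n _) (subst (_≤ 2) (↭-length p) n)) (cl d₁ p) (cr d₂ p)
  contract-modal {E} {L″} cl cr (by-D◇M t _ n d) p = E ∷ L″ , ↭-refl ,
    by-D◇M t (E ∷ L″) (≤-trans (n≤1+n _) (subst (_≤ 2) (↭-length p) n)) (cl d p)
  contract-modal {E} {L″} cl cr (by-D* t _ d) p = E ∷ L″ , ↭-refl , by-D* t (E ∷ L″) (cl d p)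
  contract-modal cl cr (by-D◇C t Π Ψ d dss) p with D◇C-drop-duplicate Π Ψ dss p
  ... | Π′ , Ψ′ , q , dss′ = Π′ ++ Ψ′ , q , by-D◇C t Π′ Ψ′ (exchangeˡ (↭-sym q) (cl d p)) dss′

  -- When both copies of A are principal (a propositional A in a
  -- left rule, or □A in a modal step), the other copy is inverted and the
  -- subformulas contracted; otherwise the rule commutes with contraction.
  contractˡ-from : ∀ A → Contractˡ-below A → Contractˡ A
  contractˡ-from A h (init p G D e f) q with ∷-↭-∷ (↭-sym e ∙ q)
  ... | inj₁ (refl , _) = init p _ D ↭-refl f
  ... | inj₂ (G₂ , _ , r₂) = init p G₂ D r₂ f
  contractˡ-from A h (L⊥ G e) q with ∷-↭-∷ (↭-sym e ∙ q)
  ... | inj₁ (refl , _) = L⊥ _ ↭-refl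
  ... | inj₂ (G₂ , _ , r₂) = L⊥ G₂ r₂
  contractˡ-from A h (L∧ E F G e d) q with ∷-↭-∷∷ (↭-sym e ∙ q)
  ... | inj₁ (refl , r) = L∧ E F _ ↭-refl (exchangeˡ (swap F E ↭-refl)
          (proj₂ h (proj₁ h (L∧⁻ d (prep E (prep F r) ∙ shifts (E ∷ F ∷ []) (E ∧' F ∷ [])))
                  (prep E (swap F E ↭-refl)))
              (swap E F ↭-refl ∙ prep F (swap E F ↭-refl))))
  ... | inj₂ (G₃ , r₁ , r₂) = L∧ E F (A ∷ G₃) (prep A r₂ ∙ swap A (E ∧' F) ↭-refl)
          (exchangeˡ (↭-sym (shifts (E ∷ F ∷ []) (A ∷ [])))
            (contractˡ-from A h d (prep E (prep F r₁) ∙ shifts (E ∷ F ∷ []) (A ∷ A ∷ []))))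
  contractˡ-from A h (L∨ E F G e d₁ d₂) q with ∷-↭-∷∷ (↭-sym e ∙ q)
  ... | inj₁ (refl , r) = L∨ E F _ ↭-refl
          (proj₁ h (L∨⁻₁ d₁ (prep E r ∙ swap E (E ∨' F) ↭-refl)) ↭-refl)
          (proj₂ h (L∨⁻₂ d₂ (prep F r ∙ swap F (E ∨' F) ↭-refl)) ↭-refl)
  ... | inj₂ (G₃ , r₁ , r₂) = L∨ E F (A ∷ G₃) (prep A r₂ ∙ swap A (E ∨' F) ↭-refl)
          (exchangeˡ (swap A E ↭-refl)
            (contractˡ-from A h d₁ (prep E r₁ ∙ shifts (E ∷ []) (A ∷ A ∷ []))))
          (exchangeˡ (swap A F ↭-refl)
            (contractˡ-from A h d₂ (prep F r₁ ∙ shifts (F ∷ []) (A ∷ A ∷ []))))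
  contractˡ-from A h (L⊃ E F G e d₁ d₂) q with ∷-↭-∷∷ (↭-sym e ∙ q)
  ... | inj₁ (refl , r) = L⊃ E F _ ↭-refl
          (proj₁ h (L⊃⁻₁ d₁ r) ↭-refl)
          (proj₂ h (L⊃⁻₂ d₂ (prep F r ∙ swap F (E ⊃ F) ↭-refl)) ↭-refl)
  ... | inj₂ (G₃ , r₁ , r₂) = L⊃ E F (A ∷ G₃) (prep A r₂ ∙ swap A (E ⊃ F) ↭-refl)
          (contractˡ-from A h d₁ r₁)
          (exchangeˡ (swap A F ↭-refl)
            (contractˡ-from A h d₂ (prep F r₁ ∙ shifts (F ∷ []) (A ∷ A ∷ []))))
  contractˡ-from A h (R∧ E F D f d₁ d₂) q =
    R∧ E F D f (contractˡ-from A h d₁ q) (contractˡ-from A h d₂ q)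
  contractˡ-from A h (R∨ E F D f d) q = R∨ E F D f (contractˡ-from A h d q)
  contractˡ-from A h (R⊃ E F D f d) q = R⊃ E F D f (exchangeˡ (swap A E ↭-refl)
          (contractˡ-from A h d (prep E q ∙ shifts (E ∷ []) (A ∷ A ∷ []))))
  contractˡ-from A h (modal {L} m e f) q with ∷-↭-□* L (↭-sym q ∙ e)
  ... | inj₂ (_ , _ , r) = modal m r f
  ... | inj₁ (E , L′ , refl , s , r) with ∷-↭-□* L′ r
  ...   | inj₂ (G′ , _ , r′) = modal m (prep (□ E) r′ ∙ ++⁺ʳ G′ (map⁺ □ (↭-sym s))) f
  ...   | inj₁ (_ , L″ , refl , s′ , r″) with contract-modal (proj₁ h) (proj₂ h) m (s ∙ prep E s′)
  ...     | L₂ , l₂ , m₂ = modal m₂ (prep (□ E) r″ ∙ ++⁺ʳ _ (map⁺ □ (↭-sym l₂))) f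

  -- Contraction of A on the right.  A boxed formula is never contracted in a
  -- modal step, whose succedent holds at most one principal formula.
  contractʳ-from : ∀ A → Contractʳ-below A → Contractʳ A
  contractʳ-from A h (init p G D e f) q with ∷-↭-∷ (↭-sym f ∙ q)
  ... | inj₁ (refl , _) = init p G _ e ↭-refl
  ... | inj₂ (D₂ , _ , r₂) = init p G D₂ e r₂
  contractʳ-from A h (L⊥ G e) q = L⊥ G e
  contractʳ-from A h (L∧ E F G e d) q = L∧ E F G e (contractʳ-from A h d q)
  contractʳ-from A h (L∨ E F G e d₁ d₂) q =
    L∨ E F G e (contractʳ-from A h d₁ q) (contractʳ-from A h d₂ q)
  contractʳ-from A h (L⊃ E F G e d₁ d₂) q = L⊃ E F G e
          (exchangeʳ (swap A E ↭-refl)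
            (contractʳ-from A h d₁ (prep E q ∙ shifts (E ∷ []) (A ∷ A ∷ []))))
          (contractʳ-from A h d₂ q)
  contractʳ-from A h (R∧ E F D f d₁ d₂) q with ∷-↭-∷∷ (↭-sym f ∙ q)
  ... | inj₁ (refl , r) = R∧ E F _ ↭-refl
          (proj₁ h (R∧⁻₁ d₁ (prep E r ∙ swap E (E ∧' F) ↭-refl)) ↭-refl)
          (proj₂ h (R∧⁻₂ d₂ (prep F r ∙ swap F (E ∧' F) ↭-refl)) ↭-refl)
  ... | inj₂ (D₃ , r₁ , r₂) = R∧ E F (A ∷ D₃) (prep A r₂ ∙ swap A (E ∧' F) ↭-refl)
          (exchangeʳ (swap A E ↭-refl)
            (contractʳ-from A h d₁ (prep E r₁ ∙ shifts (E ∷ []) (A ∷ A ∷ []))))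
          (exchangeʳ (swap A F ↭-refl)
            (contractʳ-from A h d₂ (prep F r₁ ∙ shifts (F ∷ []) (A ∷ A ∷ []))))
  contractʳ-from A h (R∨ E F D f d) q with ∷-↭-∷∷ (↭-sym f ∙ q)
  ... | inj₁ (refl , r) = R∨ E F _ ↭-refl (exchangeʳ (swap F E ↭-refl)
          (proj₂ h (proj₁ h (R∨⁻ d (prep E (prep F r) ∙ shifts (E ∷ F ∷ []) (E ∨' F ∷ [])))
                  (prep E (swap F E ↭-refl)))
              (swap E F ↭-refl ∙ prep F (swap E F ↭-refl))))
  ... | inj₂ (D₃ , r₁ , r₂) = R∨ E F (A ∷ D₃) (prep A r₂ ∙ swap A (E ∨' F) ↭-refl)
          (exchangeʳ (↭-sym (shifts (E ∷ F ∷ []) (A ∷ [])))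
            (contractʳ-from A h d (prep E (prep F r₁) ∙ shifts (E ∷ F ∷ []) (A ∷ A ∷ []))))
  contractʳ-from A h (R⊃ E F D f d) q with ∷-↭-∷∷ (↭-sym f ∙ q)
  ... | inj₁ (refl , r) = R⊃ E F _ ↭-refl
          (proj₂ h (proj₁ h (R⊃⁻ d (prep F r ∙ swap F (E ⊃ F) ↭-refl)) ↭-refl) ↭-refl)
  ... | inj₂ (D₃ , r₁ , r₂) = R⊃ E F (A ∷ D₃) (prep A r₂ ∙ swap A (E ⊃ F) ↭-refl)
          (exchangeʳ (swap A F ↭-refl)
            (contractʳ-from A h d (prep F r₁ ∙ shifts (F ∷ []) (A ∷ A ∷ []))))
  contractʳ-from A h (modal {R = R} m e f) q with ∷-↭-□* R (↭-sym q ∙ f)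
  ... | inj₂ (_ , _ , r) = modal m e r
  ... | inj₁ (B , R′ , refl , s , r) with ∷-↭-□* R′ r
  ...   | inj₂ (D′ , _ , r′) = modal m e (prep (□ B) r′ ∙ ++⁺ʳ D′ (map⁺ □ (↭-sym s)))
  ...   | inj₁ (_ , _ , _ , s′ , _) = ⊥-elim (≤1-↭-∷∷ (succedent-≤1 m) (s ∙ prep B s′))

  contractˡ : ∀ A → Contractˡ A
  contractʳ : ∀ A → Contractʳ A
  contractˡ-below : ∀ A → Contractˡ-below A
  contractʳ-below : ∀ A → Contractʳ-below A

  contractˡ A = contractˡ-from A (contractˡ-below A)
  contractʳ A = contractʳ-from A (contractʳ-below A)

  contractˡ-below (var _) = tt
  contractˡ-below ⊥' = tt
  contractˡ-below (A ∧' B) = contractˡ A , contractˡ B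
  contractˡ-below (A ∨' B) = contractˡ A , contractˡ B
  contractˡ-below (A ⊃ B) = contractʳ A , contractˡ B
  contractˡ-below (□ A) = contractˡ A , contractʳ A
  contractʳ-below (var _) = tt
  contractʳ-below ⊥' = tt
  contractʳ-below (A ∧' B) = contractʳ A , contractʳ B
  contractʳ-below (A ∨' B) = contractʳ A , contractʳ B
  contractʳ-below (A ⊃ B) = contractˡ A , contractʳ B
  contractʳ-below (□ A) = tt

  contract*ˡ : ∀ Θ {Γ Δ} → Θ ++ Θ ++ Γ ⟹ Δ → Θ ++ Γ ⟹ Δ
  contract*ˡ [] d = d
  contract*ˡ (A ∷ Θ) {Γ} d = exchangeˡ (shift A Θ Γ) (contract*ˡ Θ (exchangeˡ
    (solve 3 (λ a t g → a ⊕ (t ⊕ (t ⊕ g)) ⊜ t ⊕ (t ⊕ (a ⊕ g))) ↭-refl (A ∷ []) Θ Γ)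
    (contractˡ A d (prep A (shift A Θ (Θ ++ Γ))))))

  contract*ʳ : ∀ Θ {Γ Δ} → Γ ⟹ Θ ++ Θ ++ Δ → Γ ⟹ Θ ++ Δ
  contract*ʳ [] d = d
  contract*ʳ (A ∷ Θ) {Δ = Δ} d = exchangeʳ (shift A Θ Δ) (contract*ʳ Θ (exchangeʳ
    (solve 3 (λ a t g → a ⊕ (t ⊕ (t ⊕ g)) ⊜ t ⊕ (t ⊕ (a ⊕ g))) ↭-refl (A ∷ []) Θ Δ)
    (contractʳ A d (prep A (shift A Θ (Θ ++ Δ))))))

  Cut : Fm → Set
  Cut D = ∀ {Γ Δ Π Σ′} → Γ ⟹ D ∷ Δ → D ∷ Π ⟹ Σ′ → Γ ++ Π ⟹ Δ ++ Σ′

  Cut-below : Fm → Set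
  Cut-below (A ∧' B) = Cut A × Cut B
  Cut-below (A ∨' B) = Cut A × Cut B
  Cut-below (A ⊃ B) = Cut A × Cut B
  Cut-below (□ A) = Cut A
  Cut-below _ = ⊤

  -- Principal cuts on propositional formulas reduce to cuts on the components,
  -- followed by contraction of the side formulas that these duplicate.
  principal-∧ : ∀ {A B Γ Δ Π Σ′} → Cut A → Cut B →
                Γ ⟹ A ∷ Δ → Γ ⟹ B ∷ Δ → A ∷ B ∷ Π ⟹ Σ′ → Γ ++ Π ⟹ Δ ++ Σ′
  principal-∧ {B = B} {Γ} {Δ} {Π} cutA cutB d₁ d₁′ d₂ =
    contract*ˡ Γ (contract*ʳ Δ (cutB d₁′ (exchangeˡ (shift B Γ Π) (cutA d₁ d₂))))

  principal-∨ : ∀ {A B Γ Δ Π Σ′} → Cut A → Cut B →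
                Γ ⟹ A ∷ B ∷ Δ → A ∷ Π ⟹ Σ′ → B ∷ Π ⟹ Σ′ → Γ ++ Π ⟹ Δ ++ Σ′
  principal-∨ {Γ = Γ} {Δ} {Π} {Σ′} cutA cutB d₁ d₂ d₂′ =
    exchange (++-comm-↭ Π Γ) (++-comm-↭ Σ′ Δ) (contract*ˡ Π (contract*ʳ Σ′ (exchange
      (solve 2 (λ g p → (g ⊕ p) ⊕ p ⊜ p ⊕ (p ⊕ g)) ↭-refl Γ Π)
      (solve 2 (λ g p → (g ⊕ p) ⊕ p ⊜ p ⊕ (p ⊕ g)) ↭-refl Δ Σ′)
      (cutB (cutA d₁ d₂) d₂′))))

  principal-⊃ : ∀ {A B Γ Δ Π Σ′} → Cut A → Cut B →
                A ∷ Γ ⟹ B ∷ Δ → Π ⟹ A ∷ Σ′ → B ∷ Π ⟹ Σ′ → Γ ++ Π ⟹ Δ ++ Σ′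
  principal-⊃ {B = B} {Γ} {Δ} {Π} {Σ′} cutA cutB d₁ d₂ d₂′ =
    exchange (++-comm-↭ Π Γ) (++-comm-↭ Σ′ Δ) (contract*ˡ Π (contract*ʳ Σ′ (exchange
      (solve 2 (λ g p → (p ⊕ g) ⊕ p ⊜ p ⊕ (p ⊕ g)) ↭-refl Γ Π)
      (solve 2 (λ g p → (p ⊕ g) ⊕ p ⊜ p ⊕ (p ⊕ g)) ↭-refl Δ Σ′)
      (cutB (exchangeʳ (shift B Σ′ Δ) (cutA d₂ d₁)) d₂′))))

  -- A principal cut on □B between a modal step concluding □L₁ ⇒ □B and a
  -- modal step with principal antecedent formulas □B, □L′ and succedent □R
  -- merges the two into one modal step of X with antecedent □L₁, □L′ and
  -- succedent □R — or, when no principal formula is left (N against D⊥ or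
  -- D◇E), into a derivation of the empty sequent.
  Merged : List Fm → List Fm → List Fm → Set
  Merged L₁ L′ R = (Σ (List Fm) λ L → L ↭ L₁ ++ L′ × ModalStep L R) ⊎ [] ⟹ []

  -- Pairs of rules never found in a common calculus are excluded by
  -- `exclusive`; a step by N has no principal antecedent formula.
  merge-E : ∀ {A B L L′ R} → T (has X LR-E) → A ∷ [] ⟹ B ∷ [] → B ∷ [] ⟹ A ∷ [] →
            Cut B → ModalStep L R → L ↭ B ∷ L′ → Merged (A ∷ []) L′ R
  merge-E {A} t d₁ d₁′ cut (by-E _ _ E d₂ d₂′) p with [x]-↭-∷ p
  ... | refl , refl = inj₁ (A ∷ [] , ↭-refl , by-E t A E (cut d₁ d₂) (cut d₂′ d₁′))
  merge-E {A} t d₁ d₁′ cut (by-D⊥ t₂ _ d₂) p with [x]-↭-∷ p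
  ... | refl , refl = inj₁ (A ∷ [] , ↭-refl , by-D⊥ t₂ A (cut d₁ d₂))
  merge-E {A} {L′ = L′} t d₁ d₁′ cut (by-D◇E t₂ Π n d₂ d₂′) p =
    inj₁ (A ∷ L′ , ↭-refl , by-D◇E t₂ (A ∷ L′) (subst (_≤ 2) (↭-length p) n)
      (cut d₁ (exchangeˡ p d₂)) (exchangeʳ (↭-sym (∷↭∷ʳ A L′)) (cut (exchangeʳ p d₂′) d₁′)))
  merge-E t _ _ _ (by-M t₂ _ _ _) _ = ⊥-elim (exclusive LR-E LR-M _ t t₂)
  merge-E t _ _ _ (by-R t₂ _ _ _ _) _ = ⊥-elim (exclusive LR-E LR-R _ t t₂)
  merge-E t _ _ _ (by-C t₂ _ _ _ _ _) _ = ⊥-elim (exclusive LR-E LR-C _ t t₂)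
  merge-E t _ _ _ (by-K t₂ _ _ _) _ = ⊥-elim (exclusive LR-E LR-K _ t t₂)
  merge-E t _ _ _ (by-N _ _ _) p = []-↭-∷ p
  merge-E t _ _ _ (by-D◇M t₂ _ _ _) _ = ⊥-elim (exclusive LR-E L-D◇M _ t t₂)
  merge-E t _ _ _ (by-D◇C t₂ _ _ _ _) _ = ⊥-elim (exclusive LR-E L-D◇C _ t t₂)
  merge-E t _ _ _ (by-D* t₂ _ _) _ = ⊥-elim (exclusive LR-E L-D* _ t t₂)

  merge-M : ∀ {A B L L′ R} → T (has X LR-M) → A ∷ [] ⟹ B ∷ [] →
            Cut B → ModalStep L R → L ↭ B ∷ L′ → Merged (A ∷ []) L′ R
  merge-M {A} t d₁ cut (by-M _ _ E d₂) p with [x]-↭-∷ p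
  ... | refl , refl = inj₁ (A ∷ [] , ↭-refl , by-M t A E (cut d₁ d₂))
  merge-M {A} t d₁ cut (by-D⊥ t₂ _ d₂) p with [x]-↭-∷ p
  ... | refl , refl = inj₁ (A ∷ [] , ↭-refl , by-D⊥ t₂ A (cut d₁ d₂))
  merge-M {A} {L′ = L′} t d₁ cut (by-D◇M t₂ Π n d₂) p =
    inj₁ (A ∷ L′ , ↭-refl , by-D◇M t₂ (A ∷ L′) (subst (_≤ 2) (↭-length p) n)
      (cut d₁ (exchangeˡ p d₂)))
  merge-M t _ _ (by-E t₂ _ _ _ _) _ = ⊥-elim (exclusive LR-M LR-E _ t t₂)
  merge-M t _ _ (by-R t₂ _ _ _ _) _ = ⊥-elim (exclusive LR-M LR-R _ t t₂)
  merge-M t _ _ (by-C t₂ _ _ _ _ _) _ = ⊥-elim (exclusive LR-M LR-C _ t t₂)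
  merge-M t _ _ (by-K t₂ _ _ _) _ = ⊥-elim (exclusive LR-M LR-K _ t t₂)
  merge-M t _ _ (by-N _ _ _) p = []-↭-∷ p
  merge-M t _ _ (by-D◇E t₂ _ _ _ _) _ = ⊥-elim (exclusive LR-M L-D◇E _ t t₂)
  merge-M t _ _ (by-D◇C t₂ _ _ _ _) _ = ⊥-elim (exclusive LR-M L-D◇C _ t t₂)
  merge-M t _ _ (by-D* t₂ _ _) _ = ⊥-elim (exclusive LR-M L-D* _ t t₂)

  merge-R : ∀ {A Π B L L′ R} → T (has X LR-R) → A ∷ Π ⟹ B ∷ [] →
            Cut B → ModalStep L R → L ↭ B ∷ L′ → Merged (A ∷ Π) L′ R
  merge-R {A} {Π} {L′ = L′} t d₁ cut (by-R _ _ _ E d₂) p =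
    inj₁ (A ∷ Π ++ L′ , ↭-refl , by-R t A (Π ++ L′) E (cut d₁ (exchangeˡ p d₂)))
  merge-R {A} {Π} {L′ = L′} t d₁ cut (by-D* t₂ _ d₂) p =
    inj₁ (A ∷ Π ++ L′ , ↭-refl , by-D* t₂ _ (cut d₁ (exchangeˡ p d₂)))
  merge-R t _ _ (by-E t₂ _ _ _ _) _ = ⊥-elim (exclusive LR-R LR-E _ t t₂)
  merge-R t _ _ (by-M t₂ _ _ _) _ = ⊥-elim (exclusive LR-R LR-M _ t t₂)
  merge-R t _ _ (by-C t₂ _ _ _ _ _) _ = ⊥-elim (exclusive LR-R LR-C _ t t₂)
  merge-R t _ _ (by-K t₂ _ _ _) _ = ⊥-elim (exclusive LR-R LR-K _ t t₂)
  merge-R t _ _ (by-N _ _ _) p = []-↭-∷ p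
  merge-R t _ _ (by-D⊥ t₂ _ _) _ = ⊥-elim (exclusive LR-R L-D⊥ _ t t₂)
  merge-R t _ _ (by-D◇E t₂ _ _ _ _) _ = ⊥-elim (exclusive LR-R L-D◇E _ t t₂)
  merge-R t _ _ (by-D◇M t₂ _ _ _) _ = ⊥-elim (exclusive LR-R L-D◇M _ t t₂)
  merge-R t _ _ (by-D◇C t₂ _ _ _ _) _ = ⊥-elim (exclusive LR-R L-D◇C _ t t₂)

  merge-K : ∀ {Π B L L′ R} → T (has X LR-K) → Π ⟹ B ∷ [] →
            Cut B → ModalStep L R → L ↭ B ∷ L′ → Merged Π L′ R
  merge-K {Π} {L′ = L′} t d₁ cut (by-K _ _ E d₂) p =
    inj₁ (Π ++ L′ , ↭-refl , by-K t (Π ++ L′) E (cut d₁ (exchangeˡ p d₂)))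
  merge-K {Π} {L′ = L′} t d₁ cut (by-D* t₂ _ d₂) p =
    inj₁ (Π ++ L′ , ↭-refl , by-D* t₂ _ (cut d₁ (exchangeˡ p d₂)))
  merge-K t _ _ (by-E t₂ _ _ _ _) _ = ⊥-elim (exclusive LR-K LR-E _ t t₂)
  merge-K t _ _ (by-M t₂ _ _ _) _ = ⊥-elim (exclusive LR-K LR-M _ t t₂)
  merge-K t _ _ (by-C t₂ _ _ _ _ _) _ = ⊥-elim (exclusive LR-K LR-C _ t t₂)
  merge-K t _ _ (by-R t₂ _ _ _ _) _ = ⊥-elim (exclusive LR-K LR-R _ t t₂)
  merge-K t _ _ (by-N _ _ _) p = []-↭-∷ p
  merge-K t _ _ (by-D⊥ t₂ _ _) _ = ⊥-elim (exclusive LR-K L-D⊥ _ t t₂)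
  merge-K t _ _ (by-D◇E t₂ _ _ _ _) _ = ⊥-elim (exclusive LR-K L-D◇E _ t t₂)
  merge-K t _ _ (by-D◇M t₂ _ _ _) _ = ⊥-elim (exclusive LR-K L-D◇M _ t t₂)
  merge-K t _ _ (by-D◇C t₂ _ _ _ _) _ = ⊥-elim (exclusive LR-K L-D◇C _ t t₂)

  -- C against D◇C, where □B is among the first group Π of the D◇C step:
  -- the new D◇C step has first group A, As, Π′; its new side conditions
  -- ⇒ C, C′ come from ⇒ B, C′ and B ⇒ C by cut on B.
  merge-C-D◇C : ∀ {A As B} → T (has X L-D◇C) → A ∷ As ⟹ B ∷ [] →
                All (λ C → B ∷ [] ⟹ C ∷ []) (A ∷ As) → Cut B → ∀ Π Ψ →
                Π ++ Ψ ⟹ [] → All (λ C → All (λ C′ → [] ⟹ C ∷ C′ ∷ []) Ψ) Π →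
                ∀ {Π′ L′} → Π ↭ B ∷ Π′ → L′ ↭ Π′ ++ Ψ → Merged (A ∷ As) L′ []
  merge-C-D◇C {A} {As} t d₁ ds₁ cut Π Ψ d₂ dss₂ {Π′} s₁ s₂ =
    inj₁ (((A ∷ As) ++ Π′) ++ Ψ ,
          ↭-reflexive (List.++-assoc (A ∷ As) Π′ Ψ) ∙ ++⁺ˡ (A ∷ As) (↭-sym s₂) ,
          by-D◇C t ((A ∷ As) ++ Π′) Ψ
            (exchangeˡ (↭-reflexive (sym (List.++-assoc (A ∷ As) Π′ Ψ)))
               (cut d₁ (exchangeˡ (++⁺ʳ Ψ s₁) d₂)))
            (AllP.++⁺ (All.map (λ B⇒C → All.map (λ ⇒BC′ → exchangeʳ (swap _ _ ↭-refl) (cut ⇒BC′ B⇒C))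
                                                 (All.head dss₂′)) ds₁)
                      (All.tail dss₂′)))
    where dss₂′ = All-resp-↭ s₁ dss₂

  merge-C : ∀ {A As B L L′ R} → T (has X LR-C) → A ∷ As ⟹ B ∷ [] →
            All (λ C → B ∷ [] ⟹ C ∷ []) (A ∷ As) →
            Cut B → ModalStep L R → L ↭ B ∷ L′ → Merged (A ∷ As) L′ R
  merge-C {A} {As} {L′ = L′} t d₁ ds₁ cut (by-C _ _ _ E d₂ ds₂) p =
    inj₁ (A ∷ As ++ L′ , ↭-refl , by-C t A (As ++ L′) E (cut d₁ (exchangeˡ p d₂))
      (AllP.++⁺ (All.map (cut (All.head ds₂′)) ds₁) (All.tail ds₂′)))
    where ds₂′ = All-resp-↭ p ds₂
  merge-C t d₁ ds₁ cut (by-D◇C t₂ Π Ψ d₂ dss₂) p with ∷-↭-++ Π Ψ p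
  ... | inj₁ (Π′ , s₁ , s₂) = merge-C-D◇C t₂ d₁ ds₁ cut Π Ψ d₂ dss₂ s₁ s₂
  ... | inj₂ (Ψ′ , s₁ , s₂) = merge-C-D◇C t₂ d₁ ds₁ cut Ψ Π
          (exchangeˡ (++-comm-↭ Π Ψ) d₂)
          (All.map (All.map (exchangeʳ (swap _ _ ↭-refl))) (All-transpose dss₂))
          s₁ (s₂ ∙ ++-comm-↭ Π Ψ′)
  merge-C {A} {As} {L′ = L′} t d₁ ds₁ cut (by-D* t₂ _ d₂) p =
    inj₁ ((A ∷ As) ++ L′ , ↭-refl , by-D* t₂ _ (cut d₁ (exchangeˡ p d₂)))
  merge-C t _ _ _ (by-E t₂ _ _ _ _) _ = ⊥-elim (exclusive LR-C LR-E _ t t₂)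
  merge-C t _ _ _ (by-M t₂ _ _ _) _ = ⊥-elim (exclusive LR-C LR-M _ t t₂)
  merge-C t _ _ _ (by-R t₂ _ _ _ _) _ = ⊥-elim (exclusive LR-C LR-R _ t t₂)
  merge-C t _ _ _ (by-K t₂ _ _ _) _ = ⊥-elim (exclusive LR-C LR-K _ t t₂)
  merge-C t _ _ _ (by-N _ _ _) p = []-↭-∷ p
  merge-C t _ _ _ (by-D⊥ t₂ _ _) _ = ⊥-elim (exclusive LR-C L-D⊥ _ t t₂)
  merge-C t _ _ _ (by-D◇E t₂ _ _ _ _) _ = ⊥-elim (exclusive LR-C L-D◇E _ t t₂)
  merge-C t _ _ _ (by-D◇M t₂ _ _ _) _ = ⊥-elim (exclusive LR-C L-D◇M _ t t₂)

  -- N against C leaves the premisses of a C step for the remaining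
  -- antecedent L′, which is a step by N again when L′ is empty.
  N-or-C : ∀ {E} L′ → T (has X R-N) → T (has X LR-C) → L′ ⟹ E ∷ [] →
           All (λ C → E ∷ [] ⟹ C ∷ []) L′ → ModalStep L′ (E ∷ [])
  N-or-C {E} [] t _ d _ = by-N t E d
  N-or-C {E} (C ∷ Cs) _ t d ds = by-C t C Cs E d ds

  -- N against D◇E leaves at most one principal formula C: the empty
  -- sequent if there is none, and a step by D⊥ for C otherwise (every
  -- calculus with N and D◇E has D⊥).
  N-D◇E : ∀ {B Π} L′ → T (has X R-N) → T (has X L-D◇E) → Π ↭ B ∷ L′ → length Π ≤ 2 →
          L′ ⟹ [] → Merged [] L′ []
  N-D◇E [] _ _ _ _ d = inj₂ d
  N-D◇E (C ∷ []) t t₂ _ _ d = inj₁ (C ∷ [] , ↭-refl , by-D⊥ (entails R-N L-D◇E L-D⊥ _ t t₂) C d)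
  N-D◇E (_ ∷ _ ∷ _) _ _ p n _ with subst (_≤ 2) (↭-length p) n
  ... | s≤s (s≤s ())

  merge-N : ∀ {B L L′ R} → T (has X R-N) → [] ⟹ B ∷ [] →
            Cut B → ModalStep L R → L ↭ B ∷ L′ → Merged [] L′ R
  merge-N t d₁ cut (by-E _ _ E d₂ _) p with [x]-↭-∷ p
  ... | refl , refl = inj₁ ([] , ↭-refl , by-N t E (cut d₁ d₂))
  merge-N t d₁ cut (by-M _ _ E d₂) p with [x]-↭-∷ p
  ... | refl , refl = inj₁ ([] , ↭-refl , by-N t E (cut d₁ d₂))
  merge-N {L′ = L′} t d₁ cut (by-C t₂ _ _ _ d₂ ds₂) p =
    inj₁ (L′ , ↭-refl , N-or-C L′ t t₂ (cut d₁ (exchangeˡ p d₂)) (All.tail (All-resp-↭ p ds₂)))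
  merge-N t d₁ cut (by-D⊥ _ _ d₂) p with [x]-↭-∷ p
  ... | refl , refl = inj₂ (cut d₁ d₂)
  merge-N {L′ = L′} t d₁ cut (by-D◇E t₂ _ n d₂ _) p = N-D◇E L′ t t₂ p n (cut d₁ (exchangeˡ p d₂))
  merge-N {L′ = L′} t d₁ cut (by-D◇M t₂ _ n d₂) p =
    inj₁ (L′ , ↭-refl , by-D◇M t₂ L′ (≤-trans (n≤1+n _) (subst (_≤ 2) (↭-length p) n))
                                      (cut d₁ (exchangeˡ p d₂)))
  merge-N {L′ = L′} t d₁ cut (by-D* t₂ _ d₂) p =
    inj₁ (L′ , ↭-refl , by-D* t₂ L′ (cut d₁ (exchangeˡ p d₂)))
  merge-N t _ _ (by-R t₂ _ _ _ _) _ = ⊥-elim (exclusive R-N LR-R _ t t₂)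
  merge-N t _ _ (by-K t₂ _ _ _) _ = ⊥-elim (exclusive R-N LR-K _ t t₂)
  merge-N t _ _ (by-D◇C t₂ _ _ _ _) _ = ⊥-elim (exclusive R-N L-D◇C _ t t₂)
  merge-N t _ _ (by-N _ _ _) p = []-↭-∷ p

  merge : ∀ {B L₁ L L′ R} → Cut B → ModalStep L₁ (B ∷ []) → ModalStep L R →
          L ↭ B ∷ L′ → Merged L₁ L′ R
  merge cut (by-E t _ _ d₁ d₁′) = merge-E t d₁ d₁′ cut
  merge cut (by-M t _ _ d₁) = merge-M t d₁ cut
  merge cut (by-R t _ _ _ d₁) = merge-R t d₁ cut
  merge cut (by-C t _ _ _ d₁ ds₁) = merge-C t d₁ ds₁ cut
  merge cut (by-K t _ _ d₁) = merge-K t d₁ cut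
  merge cut (by-N t _ d₁) = merge-N t d₁ cut

  principal-succedent : ∀ {L R B R′} → ModalStep L R → R ↭ B ∷ R′ → ModalStep L (B ∷ [])
  principal-succedent (by-E t A B d₁ d₂) p with [x]-↭-∷ p
  ... | refl , refl = by-E t A B d₁ d₂
  principal-succedent (by-M t A B d) p with [x]-↭-∷ p
  ... | refl , refl = by-M t A B d
  principal-succedent (by-R t A Π B d) p with [x]-↭-∷ p
  ... | refl , refl = by-R t A Π B d
  principal-succedent (by-C t A As B d ds) p with [x]-↭-∷ p
  ... | refl , refl = by-C t A As B d ds
  principal-succedent (by-K t Π B d) p with [x]-↭-∷ p
  ... | refl , refl = by-K t Π B d
  principal-succedent (by-N t B d) p with [x]-↭-∷ p
  ... | refl , refl = by-N t B d
  principal-succedent (by-D⊥ _ _ _) p = []-↭-∷ p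
  principal-succedent (by-D◇E _ _ _ _ _) p = []-↭-∷ p
  principal-succedent (by-D◇M _ _ _ _) p = []-↭-∷ p
  principal-succedent (by-D◇C _ _ _ _ _) p = []-↭-∷ p
  principal-succedent (by-D* _ _ _) p = []-↭-∷ p

  Principalʳ : Fm → List Fm → List Fm → Set
  Principalʳ (A ∧' B) Γ Δ = Γ ⟹ A ∷ Δ × Γ ⟹ B ∷ Δ
  Principalʳ (A ∨' B) Γ Δ = Γ ⟹ A ∷ B ∷ Δ
  Principalʳ (A ⊃ B) Γ Δ = A ∷ Γ ⟹ B ∷ Δ
  Principalʳ (□ B) Γ Δ =
    Σ (List Fm) λ L₁ → Σ (List Fm) λ G₁ → ModalStep L₁ (B ∷ []) × Γ ↭ □* L₁ ++ G₁
  Principalʳ _ _ _ = ⊥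

  principal-□ : ∀ {B L₁ G₁ L L′ R G D Γ Δ Π Σ′} → Cut B →
                ModalStep L₁ (B ∷ []) → Γ ↭ □* L₁ ++ G₁ →
                ModalStep L R → L ↭ B ∷ L′ → Π ↭ □* L′ ++ G → Σ′ ↭ □* R ++ D →
                Γ ++ Π ⟹ Δ ++ Σ′
  principal-□ {L₁ = L₁} {G₁} {L′ = L′} {R} {G} {Γ = Γ} {Δ} {Π} {Σ′} cut m₁ e₁ m p e f
    with merge cut m₁ m p
  ... | inj₂ ⇒ = exchange (↭-reflexive (List.++-identityʳ _)) (↭-reflexive (List.++-identityʳ _))
                          (weaken (Γ ++ Π) (Δ ++ Σ′) ⇒)
  ... | inj₁ (L₂ , l₂ , m₂) = modal m₂
          (++⁺ e₁ e ∙
           solve 4 (λ a b c d → (a ⊕ b) ⊕ (c ⊕ d) ⊜ (a ⊕ c) ⊕ (b ⊕ d)) ↭-refl (□* L₁) G₁ (□* L′) G ∙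
           ++⁺ʳ (G₁ ++ G) (↭-reflexive (sym (List.map-++ □ L₁ L′)) ∙ map⁺ □ (↭-sym l₂)))
          (prefix-++ Δ (□* R) f)

  cut-right : ∀ D {Γ Δ Π′ Π Σ′} → Cut-below D → Principalʳ D Γ Δ →
              Π′ ⟹ Σ′ → Π′ ↭ D ∷ Π → Γ ++ Π ⟹ Δ ++ Σ′
  cut-right D {Γ} {Δ} c pr (init p G E e f) q with ∷-↭-∷ (↭-sym e ∙ q)
  ... | inj₁ (refl , _) = ⊥-elim pr
  ... | inj₂ (G₂ , _ , r₂) = init p (Γ ++ G₂) (Δ ++ E) (prefix-∷ Γ r₂) (prefix-∷ Δ f)
  cut-right D {Γ} c pr (L⊥ G e) q with ∷-↭-∷ (↭-sym e ∙ q)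
  ... | inj₁ (refl , _) = ⊥-elim pr
  ... | inj₂ (G₂ , _ , r₂) = L⊥ (Γ ++ G₂) (prefix-∷ Γ r₂)
  cut-right D {Γ} c pr (L∧ A B G e d) q with ∷-↭-∷ (↭-sym e ∙ q)
  ... | inj₁ (refl , r) =
          principal-∧ (proj₁ c) (proj₂ c) (proj₁ pr) (proj₂ pr) (exchangeˡ (prep A (prep B r)) d)
  ... | inj₂ (G₂ , r₁ , r₂) = L∧ A B (Γ ++ G₂) (prefix-∷ Γ r₂)
          (exchangeˡ (shifts Γ (A ∷ B ∷ []))
            (cut-right D c pr d (prep A (prep B r₁) ∙ shifts (A ∷ B ∷ []) (D ∷ []))))
  cut-right D {Γ} c pr (L∨ A B G e d₁ d₂) q with ∷-↭-∷ (↭-sym e ∙ q)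
  ... | inj₁ (refl , r) =
          principal-∨ (proj₁ c) (proj₂ c) pr (exchangeˡ (prep A r) d₁) (exchangeˡ (prep B r) d₂)
  ... | inj₂ (G₂ , r₁ , r₂) = L∨ A B (Γ ++ G₂) (prefix-∷ Γ r₂)
          (exchangeˡ (shift A Γ G₂) (cut-right D c pr d₁ (prep A r₁ ∙ swap A D ↭-refl)))
          (exchangeˡ (shift B Γ G₂) (cut-right D c pr d₂ (prep B r₁ ∙ swap B D ↭-refl)))
  cut-right D {Γ} {Δ} c pr (L⊃ A B G e d₁ d₂) q with ∷-↭-∷ (↭-sym e ∙ q)
  ... | inj₁ (refl , r) =
          principal-⊃ (proj₁ c) (proj₂ c) pr (exchangeˡ r d₁) (exchangeˡ (prep B r) d₂)
  ... | inj₂ (G₂ , r₁ , r₂) = L⊃ A B (Γ ++ G₂) (prefix-∷ Γ r₂)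
          (exchangeʳ (shift A Δ _) (cut-right D c pr d₁ r₁))
          (exchangeˡ (shift B Γ G₂) (cut-right D c pr d₂ (prep B r₁ ∙ swap B D ↭-refl)))
  cut-right D {Δ = Δ} c pr (R∧ A B E f d₁ d₂) q = R∧ A B (Δ ++ E) (prefix-∷ Δ f)
          (exchangeʳ (shift A Δ E) (cut-right D c pr d₁ q))
          (exchangeʳ (shift B Δ E) (cut-right D c pr d₂ q))
  cut-right D {Δ = Δ} c pr (R∨ A B E f d) q = R∨ A B (Δ ++ E) (prefix-∷ Δ f)
          (exchangeʳ (shifts Δ (A ∷ B ∷ [])) (cut-right D c pr d q))
  cut-right D {Γ} {Δ} c pr (R⊃ A B E f d) q = R⊃ A B (Δ ++ E) (prefix-∷ Δ f)
          (exchange (shift A Γ _) (shift B Δ E) (cut-right D c pr d (prep A q ∙ swap A D ↭-refl)))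
  cut-right D {Γ} {Δ} c pr (modal {L} {R} m e f) q with ∷-↭-□* L (↭-sym q ∙ e)
  ... | inj₂ (_ , _ , r) = modal m (prefix-++ Γ (□* L) r) (prefix-++ Δ (□* R) f)
  ... | inj₁ (_ , _ , refl , p , r) with pr
  ...   | _ , _ , m₁ , e₁ = principal-□ c m₁ e₁ m p r f

  cut-left : ∀ D {Γ Δ′ Δ Π Σ′} → Cut-below D →
             Γ ⟹ Δ′ → Δ′ ↭ D ∷ Δ → D ∷ Π ⟹ Σ′ → Γ ++ Π ⟹ Δ ++ Σ′
  cut-left D {Δ = Δ} {Π} c (init p G E e f) q d₂ with ∷-↭-∷ (↭-sym f ∙ q)
  ... | inj₁ (refl , _) = exchangeˡ (shift (var p) G Π ∙ ↭-sym (++⁺ʳ Π e)) (weaken G Δ d₂)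
  ... | inj₂ (E₂ , _ , r₂) = init p (G ++ Π) (E₂ ++ _) (++⁺ʳ Π e) (++⁺ʳ _ r₂)
  cut-left D {Π = Π} c (L⊥ G e) q d₂ = L⊥ (G ++ Π) (++⁺ʳ Π e)
  cut-left D {Π = Π} c (L∧ A B G e d) q d₂ = L∧ A B (G ++ Π) (++⁺ʳ Π e) (cut-left D c d q d₂)
  cut-left D {Π = Π} c (L∨ A B G e d₁ d₁′) q d₂ =
    L∨ A B (G ++ Π) (++⁺ʳ Π e) (cut-left D c d₁ q d₂) (cut-left D c d₁′ q d₂)
  cut-left D {Π = Π} c (L⊃ A B G e d₁ d₁′) q d₂ = L⊃ A B (G ++ Π) (++⁺ʳ Π e)
    (cut-left D c d₁ (prep A q ∙ swap A D ↭-refl) d₂) (cut-left D c d₁′ q d₂)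
  cut-left D {Σ′ = Σ′} c (R∧ A B E f d₁ d₁′) q d₂ with ∷-↭-∷ (↭-sym f ∙ q)
  ... | inj₁ (refl , r) =
          cut-right (A ∧' B) c (exchangeʳ (prep A r) d₁ , exchangeʳ (prep B r) d₁′) d₂ ↭-refl
  ... | inj₂ (E₂ , r₁ , r₂) = R∧ A B (E₂ ++ Σ′) (++⁺ʳ Σ′ r₂)
          (cut-left D c d₁ (prep A r₁ ∙ swap A D ↭-refl) d₂)
          (cut-left D c d₁′ (prep B r₁ ∙ swap B D ↭-refl) d₂)
  cut-left D {Σ′ = Σ′} c (R∨ A B E f d) q d₂ with ∷-↭-∷ (↭-sym f ∙ q)
  ... | inj₁ (refl , r) = cut-right (A ∨' B) c (exchangeʳ (prep A (prep B r)) d) d₂ ↭-refl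
  ... | inj₂ (E₂ , r₁ , r₂) = R∨ A B (E₂ ++ Σ′) (++⁺ʳ Σ′ r₂)
          (cut-left D c d (prep A (prep B r₁) ∙ shifts (A ∷ B ∷ []) (D ∷ [])) d₂)
  cut-left D {Σ′ = Σ′} c (R⊃ A B E f d) q d₂ with ∷-↭-∷ (↭-sym f ∙ q)
  ... | inj₁ (refl , r) = cut-right (A ⊃ B) c (exchangeʳ (prep B r) d) d₂ ↭-refl
  ... | inj₂ (E₂ , r₁ , r₂) = R⊃ A B (E₂ ++ Σ′) (++⁺ʳ Σ′ r₂)
          (cut-left D c d (prep B r₁ ∙ swap B D ↭-refl) d₂)
  cut-left D {Π = Π} {Σ′} c (modal {L} {R} m e f) q d₂ with ∷-↭-□* R (↭-sym q ∙ f)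
  ... | inj₂ (_ , _ , r) = modal m (suffix-++ (□* L) Π e) (suffix-++ (□* R) Σ′ r)
  ... | inj₁ (B , _ , refl , p , _) =
          cut-right (□ B) c (L , _ , principal-succedent m p , e) d₂ ↭-refl

  cut : ∀ D → Cut D
  cut-below : ∀ D → Cut-below D
  cut D d₁ d₂ = cut-left D (cut-below D) d₁ ↭-refl d₂
  cut-below (var _) = tt
  cut-below ⊥' = tt
  cut-below (A ∧' B) = cut A , cut B
  cut-below (A ∨' B) = cut A , cut B
  cut-below (A ⊃ B) = cut A , cut B
  cut-below (□ A) = cut A

theorem4 : (X : Calc) (D : Fm) (Γ Δ Π Σ′ : List Fm) →
    X ⊢ Γ ⇒ Δ ++ D ∷ [] → X ⊢ D ∷ Π ⇒ Σ′ → X ⊢ Γ ++ Π ⇒ Δ ++ Σ′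
theorem4 X D Γ Δ Π Σ′ d₁ d₂ =
  extract (cut D (exchangeʳ (↭-sym (∷↭∷ʳ D Δ)) (embed d₁)) (embed d₂))
  where open CutAdmissibility X
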